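{- Let $G=(V,E)$ be a multigraph (loops and parallel edges allowed) with $n$ vertices, $m$ edges and $c(G)$ components. Then $$P(\mathcal{H}_G,\lambda)=\lambda^{m-n+2c(G)}\cdot(-1)^{n+c(G)}\cdot T_G\!\left(1-\lambda^2,\tfrac{\lambda-1}{\lambda}\right).$$
   Context: A hypergraph $\mathcal{H}=(\mathcal{V},\mathcal{E})$ consists of a finite vertex set $\mathcal{V}$ and a set $\mathcal{E}$ of subsets $e\subseteq\mathcal{V}$ with $|e|\ge1$. For a positive integer $\lambda$, a weak proper $\lambda$-colouring of $\mathcal{H}$ is a map $\phi:\mathcal{V}\to\{1,\dots,\lambda\}$ with $|\{\phi(v):v\in e\}|>1$ for all $e\in\mathcal{E}$; the chromatic polynomial $P(\mathcal{H},\lambda)$ is the polynomial counting these for positive integers $\lambda$. For a multigraph $G=(V,E)$, $\mathcal{H}_G$ is the hypergraph with vertex set $V\cup\{w_e:e\in E\}$ (the $w_e$ are new distinct vertices) and edge set $\{\{u_e,v_e,w_e\}:e\in E\}$, where $u_e,v_e$ are the ends of $e$ (so for a loop the edge is $\{u_e,w_e\}$). The Tutte polynomial is $T_G(x,y)=\sum_{A\subseteq E}(x-1)^{r(E)-r(A)}(y-1)^{|A|-r(A)}$, where $r(A)=|V|-c(A)$ and $c(A)$ is the number of components of the spanning subgraph $(V,A)$; $c(G)=c(E)$. -}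

module Defs where

open import Data.Nat as ℕ using (ℕ; zero; suc; _∸_)
open import Data.Fin using (Fin; zero; suc; _↑ˡ_; _↑ʳ_)
open import Data.Fin.Properties using (_≟_)
open import Data.Bool using (Bool; true; false; _∧_; _∨_; not; if_then_else_)
open import Data.Product using (_×_; _,_; proj₁; proj₂)
open import Data.List as List using (List; []; _∷_; length; filter; concatMap)
open import Data.Bool.ListAction using (any; all)
open import Data.Vec as Vec using (Vec; []; _∷_; lookup)
open import Data.Integer as ℤ using (ℤ)
open import Data.Rational as ℚ using (ℚ; 0ℚ; 1ℚ)
open import Relation.Nullary.Decidable using (⌊_⌋)

record Multigraph (n m : ℕ) : Set where
  field
    ends : Fin m → Fin n × Fin n
open Multigraph public

allFins : (k : ℕ) → List (Fin k)
allFins zero = []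
allFins (suc k) = zero ∷ List.map suc (allFins k)

allVecs : (k N : ℕ) → List (Vec (Fin k) N)
allVecs k zero = [] ∷ []
allVecs k (suc N) = concatMap (λ x → List.map (x ∷_) (allVecs k N)) (allFins k)

-- all subsets of Fin m, as characteristic vectors
allSubsets : (m : ℕ) → List (Vec Bool m)
allSubsets zero = [] ∷ []
allSubsets (suc m) = concatMap (λ b → List.map (b ∷_) (allSubsets m)) (true ∷ false ∷ [])

count : ∀ {A : Set} → (A → Bool) → List A → ℕ
count p xs = length (filter (λ x → Data.Bool._≟_ (p x) true) xs)
  where import Data.Bool

_==_ : ∀ {k} → Fin k → Fin k → Bool
x == y = ⌊ x ≟ y ⌋

-- Hypergraphs: vertex set Fin N, edges given as a list of (nonempty)
-- vertex lists; an edge is the set of vertices occurring in its list.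

record Hypergraph (N : ℕ) : Set where
  field
    hedges : List (List (Fin N))
open Hypergraph public

isWeakProper : ∀ {N k} → Hypergraph N → Vec (Fin k) N → Bool
isWeakProper H φ =
  all (λ e → any (λ u → any (λ v → not (lookup φ u == lookup φ v)) e) e) (hedges H)

-- P(H, λ) evaluated at a natural number λ: number of weak proper λ-colourings
chromPoly : ∀ {N} → Hypergraph N → ℕ → ℕ
chromPoly {N} H λ′ = count (isWeakProper H) (allVecs λ′ N)

-- The hypergraph H_G: vertices V ⊎ {w_e}, encoded as Fin (n + m) with
-- v ↦ v ↑ˡ m and w_e ↦ n ↑ʳ e; edges {u_e, v_e, w_e}.
HG : ∀ {n m} → Multigraph n m → Hypergraph (n ℕ.+ m)
HG {n} {m} G = record { hedges = List.map edge (allFins m) }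
  where
    edge : Fin m → List (Fin (n ℕ.+ m))
    edge e = (proj₁ (ends G e) ↑ˡ m) ∷ (proj₂ (ends G e) ↑ˡ m) ∷ (n ↑ʳ e) ∷ []

-- reach k A u v : there is a walk of length ≤ k from u to v using edges of A
reach : ∀ {n m} → Multigraph n m → ℕ → Vec Bool m → Fin n → Fin n → Bool
reach G zero A u v = u == v
reach {n} {m} G (suc k) A u v =
  reach G k A u v ∨
  any (λ e → lookup A e ∧
        ((reach G k A u (proj₁ (ends G e)) ∧ (proj₂ (ends G e) == v)) ∨
         (reach G k A u (proj₂ (ends G e)) ∧ (proj₁ (ends G e) == v))))
      (allFins m)

-- u and v lie in the same component of (V, A)  (walks of length ≤ n suffice)
connected : ∀ {n m} → Multigraph n m → Vec Bool m → Fin n → Fin n → Bool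
connected {n} G A u v = reach G n A u v

-- c(A): number of components of (V, A), counted via their least vertex
c : ∀ {n m} → Multigraph n m → Vec Bool m → ℕ
c {n} G A = count (λ v → not (any (λ w → ⌊ Data.Fin._<?_ w v ⌋ ∧ connected G A v w) (allFins n))) (allFins n)
  where import Data.Fin

allEdges : (m : ℕ) → Vec Bool m
allEdges m = Vec.replicate m true

cG : ∀ {n m} → Multigraph n m → ℕ
cG {m = m} G = c G (allEdges m)

rk : ∀ {n m} → Multigraph n m → Vec Bool m → ℕ
rk {n} G A = n ∸ c G A

size : ∀ {m} → Vec Bool m → ℕ
size A = count (λ b → b) (Vec.toList A)

_^ℚ_ : ℚ → ℕ → ℚ
x ^ℚ zero = 1ℚ
x ^ℚ suc k = x ℚ.* (x ^ℚ k)

sumℚ : List ℚ → ℚ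
sumℚ = List.foldr ℚ._+_ 0ℚ

tutte : ∀ {n m} → Multigraph n m → ℚ → ℚ → ℚ
tutte {n} {m} G x y =
  sumℚ (List.map (λ A → ((x ℚ.- 1ℚ) ^ℚ (rk G (allEdges m) ∸ rk G A)) ℚ.*
                        ((y ℚ.- 1ℚ) ^ℚ (size A ∸ rk G A)))
                 (allSubsets m))

ℕtoℚ : ℕ → ℚ
ℕtoℚ k = ℤ.+ k ℚ./ 1

module Submission where

open import Defs
open import Data.Nat as ℕ using (ℕ; NonZero; _+_; _*_; _∸_)
open import Data.Integer as ℤ using (ℤ)
open import Data.Rational as ℚ using (ℚ; 1ℚ)
open import Relation.Binary.PropositionalEquality using (_≡_)

open import Level using (Level)
open import Algebra.Bundles using (CommutativeSemiring; CommutativeRing)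
import Algebra.Properties.CommutativeSemigroup as CSemigroupProps
open import Data.Nat using (zero; suc; _≤_; _<_; z≤n; s≤s; _^_)
import Data.Nat.Properties as NP
open import Data.Nat.Tactic.RingSolver using (solve-∀)
open import Data.Fin as F using (Fin; zero; suc; toℕ; _↑ˡ_; _↑ʳ_)
import Data.Fin.Properties as FP
import Data.Bool.Properties as BP
import Data.List.Properties as LP
import Data.Vec.Properties as VP
open import Data.Bool.ListAction using (any; all; and; or)
import Data.Rational.Properties as QP
import Data.Rational.Unnormalised as U
import Data.Rational.Unnormalised.Properties as UP
import Data.Integer.Properties as ZP
open import Data.Integer.Solver using () renaming (module +-*-Solver to ZS)
open import Data.Rational.Solver using () renaming (module +-*-Solver to QS)
open import Algebra.Properties.Semiring.Sum NP.+-*-semiring using (sum; sum-cong-≗; *-distribʳ-sum)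
open import Data.Bool using (Bool; true; false; _∧_; _∨_; not; if_then_else_)
open import Data.Product using (Σ; _×_; _,_; proj₁; proj₂)
open import Data.Sum using (_⊎_; inj₁; inj₂)
open import Data.Empty using (⊥; ⊥-elim)
open import Data.List as L using (List; []; _∷_; concatMap)
open import Data.Vec as V using (Vec; []; _∷_; lookup)
open import Relation.Nullary using (Dec; yes; no)
open import Relation.Binary.Definitions using (tri<; tri≈; tri>)
open import Relation.Nullary.Decidable using (⌊_⌋)
open import Relation.Binary.PropositionalEquality
  using (refl; sym; trans; cong; cong₂; subst; subst₂; _≢_; module ≡-Reasoning)
open import Function using (_∘_)

-- Colour the vertices V first.  A colouring φ of V extends to a weak proper
-- colouring of H_G in λ − [φ(u_e) = φ(v_e)] ways at each w_e, so
--   P(H_G, λ) = Σ_φ Π_e (λ − [φ(u_e) = φ(v_e)]).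
-- Expanding the product over subsets A ⊆ E and exchanging the sums gives
--   P(H_G, λ) = Σ_A (−1)^|A| λ^(m−|A|) · #{φ constant on the edges of A}
--             = Σ_A (−1)^|A| λ^(m−|A|) λ^c(A),
-- because such φ are exactly the solutions of an acyclic system of constraints
-- in which the least vertex of each component of (V, A) is free and every other
-- vertex copies an earlier vertex of its component.  Finally, for x − 1 = −λ²
-- and y − 1 = −1/λ each summand equals λ^(m−n+2c(G)) (−1)^(n+c(G)) times the
-- Tutte term of A; the truncated subtractions in the exponents are exact by
-- c(E) ≤ c(A) ≤ n and n ≤ |A| + c(A), the latter by deleting edges one by one.

ind : Bool → ℕ
ind true = 1
ind false = 0

false≢true : false ≢ true
false≢true ()

∨-true : ∀ a b → a ∨ b ≡ true → a ≡ true ⊎ b ≡ true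
∨-true true b h = inj₁ refl
∨-true false b h = inj₂ h

∧-true : ∀ a b → a ∧ b ≡ true → a ≡ true × b ≡ true
∧-true true true h = refl , refl

∨-trueˡ : ∀ a b → a ≡ true → a ∨ b ≡ true
∨-trueˡ a b refl = refl

∨-trueʳ : ∀ a b → b ≡ true → a ∨ b ≡ true
∨-trueʳ true b h = refl
∨-trueʳ false b h = h

∧-intro : ∀ a b → a ≡ true → b ≡ true → a ∧ b ≡ true
∧-intro a b refl refl = refl

bool-ext : ∀ {a b} → (a ≡ true → b ≡ true) → (b ≡ true → a ≡ true) → a ≡ b
bool-ext {true} {true} f g = refl
bool-ext {true} {false} f g = ⊥-elim (false≢true (f refl))
bool-ext {false} {true} f g = ⊥-elim (false≢true (g refl))
bool-ext {false} {false} f g = refl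

implies-≢ : ∀ a b → (a ≡ true → b ≡ true) → a ≢ b → a ≡ false × b ≡ true
implies-≢ true b a⇒b a≢b = ⊥-elim (a≢b (sym (a⇒b refl)))
implies-≢ false true a⇒b a≢b = refl , refl
implies-≢ false false a⇒b a≢b = ⊥-elim (a≢b refl)

==-refl : ∀ {k} (x : Fin k) → (x == x) ≡ true
==-refl x with x FP.≟ x
... | yes _ = refl
... | no x≢x = ⊥-elim (x≢x refl)

==-sound : ∀ {k} {x y : Fin k} → (x == y) ≡ true → x ≡ y
==-sound {x = x} {y} h with x FP.≟ y
... | yes p = p
... | no _ = ⊥-elim (false≢true h)

≢⇒==-false : ∀ {k} {x y : Fin k} → x ≢ y → (x == y) ≡ false
≢⇒==-false {x = x} {y} x≢y with x FP.≟ y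
... | yes x≡y = ⊥-elim (x≢y x≡y)
... | no _ = refl

==-suc : ∀ {k} (x y : Fin k) → (suc x == suc y) ≡ (x == y)
==-suc x y with x FP.≟ y
... | yes refl = refl
... | no _ = refl

<?-sound : ∀ {n} {w v : Fin n} → ⌊ w F.<? v ⌋ ≡ true → w F.< v
<?-sound {w = w} {v} h with w F.<? v
... | yes p = p
... | no _ = ⊥-elim (false≢true h)

<?-complete : ∀ {n} {w v : Fin n} → w F.< v → ⌊ w F.<? v ⌋ ≡ true
<?-complete {w = w} {v} w<v with w F.<? v
... | yes _ = refl
... | no w≮v = ⊥-elim (w≮v w<v)

-- Finite sums over lists and products over Fin m, in any commutative semiring;
-- they are used both for counting (in ℕ) and for the final identity (in ℚ).

module Sums {c ℓ : Level} (R : CommutativeSemiring c ℓ) where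
  open CommutativeSemiring R
    using (Carrier; _≈_; 0#; 1#; setoid; +-cong; +-congˡ; +-congʳ; *-cong; *-congˡ; +-identityˡ; +-identityʳ;
           +-assoc; +-comm; zeroʳ; distribˡ; distribʳ; +-commutativeSemigroup)
    renaming (_+_ to _⊕_; _*_ to _⊛_; refl to ≈-refl; sym to ≈-sym; trans to ≈-trans)
  open import Relation.Binary.Reasoning.Setoid setoid

  sumOver : {A : Set} → (A → Carrier) → List A → Carrier
  sumOver f xs = L.foldr _⊕_ 0# (L.map f xs)

  sumOver-cong : {A : Set} {f g : A → Carrier} → (∀ x → f x ≈ g x) → ∀ xs → sumOver f xs ≈ sumOver g xs
  sumOver-cong h [] = ≈-refl
  sumOver-cong h (x ∷ xs) = +-cong (h x) (sumOver-cong h xs)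

  sumOver-++ : {A : Set} (f : A → Carrier) (xs ys : List A) → sumOver f (xs L.++ ys) ≈ sumOver f xs ⊕ sumOver f ys
  sumOver-++ f [] ys = ≈-sym (+-identityˡ _)
  sumOver-++ f (x ∷ xs) ys = ≈-trans (+-congˡ (sumOver-++ f xs ys)) (≈-sym (+-assoc (f x) _ _))

  sumOver-map : {A B : Set} (f : B → Carrier) (g : A → B) (xs : List A) → sumOver f (L.map g xs) ≈ sumOver (f ∘ g) xs
  sumOver-map f g [] = ≈-refl
  sumOver-map f g (x ∷ xs) = +-congˡ (sumOver-map f g xs)

  sumOver-concatMap : {A B : Set} (f : B → Carrier) (g : A → List B) (xs : List A) →
    sumOver f (concatMap g xs) ≈ sumOver (λ x → sumOver f (g x)) xs
  sumOver-concatMap f g [] = ≈-refl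
  sumOver-concatMap f g (x ∷ xs) =
    ≈-trans (sumOver-++ f (g x) (concatMap g xs)) (+-congˡ (sumOver-concatMap f g xs))

  sumOver-+ : {A : Set} (f g : A → Carrier) (xs : List A) → sumOver (λ x → f x ⊕ g x) xs ≈ sumOver f xs ⊕ sumOver g xs
  sumOver-+ f g [] = ≈-sym (+-identityˡ 0#)
  sumOver-+ f g (x ∷ xs) = ≈-trans (+-congˡ (sumOver-+ f g xs))
    (CSemigroupProps.interchange +-commutativeSemigroup (f x) (g x) (sumOver f xs) (sumOver g xs))

  sumOver-*ˡ : {A : Set} (k : Carrier) (f : A → Carrier) (xs : List A) → sumOver (λ x → k ⊛ f x) xs ≈ k ⊛ sumOver f xs
  sumOver-*ˡ k f [] = ≈-sym (zeroʳ k)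
  sumOver-*ˡ k f (x ∷ xs) = ≈-trans (+-congˡ (sumOver-*ˡ k f xs)) (≈-sym (distribˡ k (f x) _))

  sumOver-zero : {A : Set} (xs : List A) → sumOver (λ _ → 0#) xs ≈ 0#
  sumOver-zero [] = ≈-refl
  sumOver-zero (x ∷ xs) = ≈-trans (+-identityˡ _) (sumOver-zero xs)

  sumOver-swap : {A B : Set} (f : A → B → Carrier) (xs : List A) (ys : List B) →
    sumOver (λ x → sumOver (f x) ys) xs ≈ sumOver (λ y → sumOver (λ x → f x y) xs) ys
  sumOver-swap f [] ys = ≈-sym (sumOver-zero ys)
  sumOver-swap f (x ∷ xs) ys = ≈-trans (+-congˡ (sumOver-swap f xs ys))
    (≈-sym (sumOver-+ (f x) (λ y → sumOver (λ x → f x y) xs) ys))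

  prodFin : (m : ℕ) → (Fin m → Carrier) → Carrier
  prodFin zero f = 1#
  prodFin (suc m) f = f zero ⊛ prodFin m (f ∘ suc)

  prodFin-cong : ∀ m {f g : Fin m → Carrier} → (∀ e → f e ≈ g e) → prodFin m f ≈ prodFin m g
  prodFin-cong zero h = ≈-refl
  prodFin-cong (suc m) h = *-cong (h zero) (prodFin-cong m (h ∘ suc))

  expand-prod : ∀ m (f g : Fin m → Carrier) →
    prodFin m (λ e → f e ⊕ g e)
      ≈ sumOver (λ A → prodFin m (λ e → if lookup A e then g e else f e)) (allSubsets m)
  expand-prod zero f g = ≈-sym (+-identityʳ 1#)
  expand-prod (suc m) f g = begin
      (f zero ⊕ g zero) ⊛ prodFin m (λ e → f (suc e) ⊕ g (suc e))
        ≈⟨ *-congˡ (expand-prod m (f ∘ suc) (g ∘ suc)) ⟩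
      (f zero ⊕ g zero) ⊛ sumOver h S
        ≈⟨ distribʳ _ (f zero) (g zero) ⟩
      f zero ⊛ sumOver h S ⊕ g zero ⊛ sumOver h S
        ≈⟨ +-comm _ _ ⟩
      g zero ⊛ sumOver h S ⊕ f zero ⊛ sumOver h S
        ≈⟨ +-cong (≈-sym (sumOver-*ˡ (g zero) h S)) (≈-sym (+-identityʳ _)) ⟩
      sumOver (λ A → g zero ⊛ h A) S ⊕ (f zero ⊛ sumOver h S ⊕ 0#)
        ≈⟨ +-cong (≈-sym (sumOver-map H (true ∷_) S))
                  (+-congʳ (≈-trans (≈-sym (sumOver-*ˡ (f zero) h S)) (≈-sym (sumOver-map H (false ∷_) S)))) ⟩
      sumOver (λ b → sumOver H (L.map (b ∷_) S)) (true ∷ false ∷ [])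
        ≈⟨ ≈-sym (sumOver-concatMap H (λ b → L.map (b ∷_) S) (true ∷ false ∷ [])) ⟩
      sumOver H (allSubsets (suc m)) ∎
    where
    S = allSubsets m
    h : Vec Bool m → Carrier
    h A = prodFin m (λ e → if lookup A e then g (suc e) else f (suc e))
    H : Vec Bool (suc m) → Carrier
    H A = prodFin (suc m) (λ e → if lookup A e then g e else f e)

module ℕΣ = Sums NP.+-*-commutativeSemiring
module ℚΣ = Sums (CommutativeRing.commutativeSemiring QP.+-*-commutativeRing)

count-as-sum : {A : Set} (p : A → Bool) (xs : List A) → count p xs ≡ ℕΣ.sumOver (ind ∘ p) xs
count-as-sum p [] = refl
count-as-sum p (x ∷ xs) with p x
... | true = cong suc (count-as-sum p xs)
... | false = count-as-sum p xs

sumOver-allFins : ∀ n (f : Fin n → ℕ) → ℕΣ.sumOver f (allFins n) ≡ sum f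
sumOver-allFins zero f = refl
sumOver-allFins (suc n) f =
  cong (f zero +_) (trans (ℕΣ.sumOver-map f suc (allFins n)) (sumOver-allFins n (f ∘ suc)))

countFin : (n : ℕ) → (Fin n → Bool) → ℕ
countFin n p = sum (ind ∘ p)

count-allFins : ∀ n (p : Fin n → Bool) → count p (allFins n) ≡ countFin n p
count-allFins n p = trans (count-as-sum p (allFins n)) (sumOver-allFins n (ind ∘ p))

sum-const : ∀ k C → sum {k} (λ _ → C) ≡ k * C
sum-const zero C = refl
sum-const (suc k) C = cong (C +_) (sum-const k C)

sum-delta : ∀ k (a : Fin k) C → sum (λ x → ind (x == a) * C) ≡ C
sum-delta (suc k) zero C rewrite ==-refl (zero {k}) = begin
    (C + 0) + sum {k} (λ x → ind (suc x == zero) * C)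
      ≡⟨ cong₂ _+_ (NP.+-identityʳ C) (sum-cong-≗ {k} (λ x → cong (λ b → ind b * C) (≢⇒==-false {x = suc x} {zero} (λ ())))) ⟩
    C + sum {k} (λ _ → 0)
      ≡⟨ cong (C +_) (trans (sum-const k 0) (NP.*-zeroʳ k)) ⟩
    C + 0
      ≡⟨ NP.+-identityʳ C ⟩
    C ∎
  where open ≡-Reasoning
sum-delta (suc k) (suc a) C rewrite ≢⇒==-false {x = zero {k}} {suc a} (λ ()) =
  trans (sum-cong-≗ {k} (λ x → cong (λ b → ind b * C) (==-suc x a))) (sum-delta k a C)

countFin-true : ∀ n → countFin n (λ _ → true) ≡ n
countFin-true zero = refl
countFin-true (suc n) = cong suc (countFin-true n)

countFin-false : ∀ n → countFin n (λ _ → false) ≡ 0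
countFin-false zero = refl
countFin-false (suc n) = countFin-false n

countFin-≤ : ∀ n (p : Fin n → Bool) → countFin n p ≤ n
countFin-≤ zero p = z≤n
countFin-≤ (suc n) p with p zero
... | true = s≤s (countFin-≤ n (p ∘ suc))
... | false = NP.m≤n⇒m≤1+n (countFin-≤ n (p ∘ suc))

countFin-mono : ∀ n (p q : Fin n → Bool) → (∀ x → p x ≡ true → q x ≡ true) → countFin n p ≤ countFin n q
countFin-mono zero p q p⇒q = z≤n
countFin-mono (suc n) p q p⇒q with p zero in p₀ | q zero in q₀
... | true | true = s≤s (countFin-mono n (p ∘ suc) (q ∘ suc) (p⇒q ∘ suc))
... | true | false = ⊥-elim (false≢true (trans (sym q₀) (p⇒q zero p₀)))
... | false | true = NP.m≤n⇒m≤1+n (countFin-mono n (p ∘ suc) (q ∘ suc) (p⇒q ∘ suc))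
... | false | false = countFin-mono n (p ∘ suc) (q ∘ suc) (p⇒q ∘ suc)

countFin-strict : ∀ n (p q : Fin n → Bool) → (∀ x → p x ≡ true → q x ≡ true) →
  ∀ x → p x ≡ false → q x ≡ true → countFin n p < countFin n q
countFin-strict (suc n) p q p⇒q zero px qx rewrite px | qx =
  s≤s (countFin-mono n (p ∘ suc) (q ∘ suc) (p⇒q ∘ suc))
countFin-strict (suc n) p q p⇒q (suc x) px qx with p zero in p₀ | q zero in q₀
... | true | true = s≤s (countFin-strict n (p ∘ suc) (q ∘ suc) (p⇒q ∘ suc) x px qx)
... | true | false = ⊥-elim (false≢true (trans (sym q₀) (p⇒q zero p₀)))
... | false | true = NP.m≤n⇒m≤1+n (countFin-strict n (p ∘ suc) (q ∘ suc) (p⇒q ∘ suc) x px qx)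
... | false | false = countFin-strict n (p ∘ suc) (q ∘ suc) (p⇒q ∘ suc) x px qx

countFin-pos : ∀ n (p : Fin n → Bool) x → p x ≡ true → 0 < countFin n p
countFin-pos n p x px = subst (_< countFin n p) (countFin-false n)
  (countFin-strict n (λ _ → false) p (λ _ ()) x refl px)

AtMostOneOutside : ∀ {n} → (Fin n → Bool) → (Fin n → Bool) → Set
AtMostOneOutside p q = ∀ x y → p x ≡ true → q x ≡ false → p y ≡ true → q y ≡ false → x ≡ y

unique-suc : ∀ {n} (p q : Fin (suc n) → Bool) → AtMostOneOutside p q → AtMostOneOutside (p ∘ suc) (q ∘ suc)
unique-suc p q unique x y px qx py qy = FP.suc-injective (unique (suc x) (suc y) px qx py qy)

countFin-≤-suc : ∀ n (p q : Fin n → Bool) → (∀ x → q x ≡ true → p x ≡ true) →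
  AtMostOneOutside p q → countFin n p ≤ suc (countFin n q)
countFin-≤-suc zero p q q⇒p unique = z≤n
countFin-≤-suc (suc n) p q q⇒p unique with p zero in p₀ | q zero in q₀
... | true | true = s≤s (countFin-≤-suc n (p ∘ suc) (q ∘ suc) (q⇒p ∘ suc) (unique-suc p q unique))
... | false | false = countFin-≤-suc n (p ∘ suc) (q ∘ suc) (q⇒p ∘ suc) (unique-suc p q unique)
... | false | true = ⊥-elim (false≢true (trans (sym p₀) (q⇒p zero q₀)))
... | true | false = s≤s (countFin-mono n (p ∘ suc) (q ∘ suc) p⇒q)
  where
  -- zero is the only element of p ∖ q, so p ⊆ q on the remaining ones
  p⇒q : ∀ x → p (suc x) ≡ true → q (suc x) ≡ true
  p⇒q x px with q (suc x) in qx
  ... | true = refl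
  ... | false with () ← unique zero (suc x) p₀ q₀ px qx

anyFin : (n : ℕ) → (Fin n → Bool) → Bool
anyFin zero p = false
anyFin (suc n) p = p zero ∨ anyFin n (p ∘ suc)

allFin : (n : ℕ) → (Fin n → Bool) → Bool
allFin zero p = true
allFin (suc n) p = p zero ∧ allFin n (p ∘ suc)

any-allFins : ∀ n (p : Fin n → Bool) → any p (allFins n) ≡ anyFin n p
any-allFins zero p = refl
any-allFins (suc n) p = cong (p zero ∨_) (trans (cong or (sym (LP.map-∘ (allFins n)))) (any-allFins n (p ∘ suc)))

all-allFins : ∀ n (p : Fin n → Bool) → all p (allFins n) ≡ allFin n p
all-allFins zero p = refl
all-allFins (suc n) p = cong (p zero ∧_) (trans (cong and (sym (LP.map-∘ (allFins n)))) (all-allFins n (p ∘ suc)))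

anyFin-cong : ∀ n {p q : Fin n → Bool} → (∀ x → p x ≡ q x) → anyFin n p ≡ anyFin n q
anyFin-cong zero h = refl
anyFin-cong (suc n) h = cong₂ _∨_ (h zero) (anyFin-cong n (h ∘ suc))

allFin-cong : ∀ n {p q : Fin n → Bool} → (∀ x → p x ≡ q x) → allFin n p ≡ allFin n q
allFin-cong zero h = refl
allFin-cong (suc n) h = cong₂ _∧_ (h zero) (allFin-cong n (h ∘ suc))

anyFin-intro : ∀ n (p : Fin n → Bool) x → p x ≡ true → anyFin n p ≡ true
anyFin-intro (suc n) p zero px rewrite px = refl
anyFin-intro (suc n) p (suc x) px rewrite anyFin-intro n (p ∘ suc) x px = BP.∨-zeroʳ (p zero)

anyFin-elim : ∀ n (p : Fin n → Bool) → anyFin n p ≡ true → Σ (Fin n) (λ x → p x ≡ true)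
anyFin-elim (suc n) p h with p zero in p₀
... | true = zero , p₀
... | false = let (x , px) = anyFin-elim n (p ∘ suc) h in suc x , px

anyFin-false : ∀ n (p : Fin n → Bool) → anyFin n p ≡ false → ∀ x → p x ≡ false
anyFin-false (suc n) p h x with p zero in p₀ | x
... | false | zero = p₀
... | false | suc x′ = anyFin-false n (p ∘ suc) h x′

anyFin-none : ∀ n (p : Fin n → Bool) → (∀ x → p x ≡ false) → anyFin n p ≡ false
anyFin-none zero p h = refl
anyFin-none (suc n) p h rewrite h zero = anyFin-none n (p ∘ suc) (h ∘ suc)

allFin-intro : ∀ n (p : Fin n → Bool) → (∀ x → p x ≡ true) → allFin n p ≡ true
allFin-intro zero p h = refl
allFin-intro (suc n) p h rewrite h zero = allFin-intro n (p ∘ suc) (h ∘ suc)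

allFin-elim : ∀ n (p : Fin n → Bool) → allFin n p ≡ true → ∀ x → p x ≡ true
allFin-elim (suc n) p h x with p zero in p₀ | x
... | true | zero = p₀
... | true | suc x′ = allFin-elim n (p ∘ suc) h x′

_⊆ₑ_ : ∀ {m} → Vec Bool m → Vec Bool m → Set
A′ ⊆ₑ A = ∀ e → lookup A′ e ≡ true → lookup A e ≡ true

module Connectivity {n m : ℕ} (G : Multigraph n m) where

  end₁ end₂ : Fin m → Fin n
  end₁ e = proj₁ (ends G e)
  end₂ e = proj₂ (ends G e)

  extends : ℕ → Vec Bool m → Fin n → Fin n → Fin m → Bool
  extends k A u v e = lookup A e ∧ ((reach G k A u (end₁ e) ∧ (end₂ e == v)) ∨ (reach G k A u (end₂ e) ∧ (end₁ e == v)))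

  reach-suc : ∀ k A u v → reach G (suc k) A u v ≡ (reach G k A u v ∨ anyFin m (extends k A u v))
  reach-suc k A u v = cong (reach G k A u v ∨_) (any-allFins m (extends k A u v))

  reach-refl : ∀ A u → reach G 0 A u u ≡ true
  reach-refl A u = ==-refl u

  reach-step : ∀ k A u v → reach G k A u v ≡ true → reach G (suc k) A u v ≡ true
  reach-step k A u v r = trans (reach-suc k A u v) (∨-trueˡ _ _ r)

  reach-mono : ∀ {k j} → k ≤ j → ∀ A u v → reach G k A u v ≡ true → reach G j A u v ≡ true
  reach-mono {k} {j} k≤j A u v r = subst (λ i → reach G i A u v ≡ true) (NP.m∸n+n≡m k≤j) (go (j ∸ k))
    where
    go : ∀ d → reach G (d + k) A u v ≡ true
    go zero = r
    go (suc d) = reach-step (d + k) A u v (go d)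

  reach-edge₁ : ∀ k A u e → lookup A e ≡ true → reach G k A u (end₁ e) ≡ true → reach G (suc k) A u (end₂ e) ≡ true
  reach-edge₁ k A u e e∈A r = trans (reach-suc k A u (end₂ e))
    (∨-trueʳ _ _ (anyFin-intro m (extends k A u (end₂ e)) e
      (∧-intro _ _ e∈A (∨-trueˡ _ _ (∧-intro _ _ r (==-refl (end₂ e)))))))

  reach-edge₂ : ∀ k A u e → lookup A e ≡ true → reach G k A u (end₂ e) ≡ true → reach G (suc k) A u (end₁ e) ≡ true
  reach-edge₂ k A u e e∈A r = trans (reach-suc k A u (end₁ e))
    (∨-trueʳ _ _ (anyFin-intro m (extends k A u (end₁ e)) e
      (∧-intro _ _ e∈A (∨-trueʳ (reach G k A u (end₁ e) ∧ (end₂ e == end₁ e)) _ (∧-intro _ _ r (==-refl (end₁ e)))))))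

  data LastStep (k : ℕ) (A : Vec Bool m) (u v : Fin n) : Set where
    shorter : reach G k A u v ≡ true → LastStep k A u v
    forward : ∀ e → lookup A e ≡ true → reach G k A u (end₁ e) ≡ true → end₂ e ≡ v → LastStep k A u v
    backward : ∀ e → lookup A e ≡ true → reach G k A u (end₂ e) ≡ true → end₁ e ≡ v → LastStep k A u v

  lastStep : ∀ k A u v → reach G (suc k) A u v ≡ true → LastStep k A u v
  lastStep k A u v r with ∨-true _ _ (trans (sym (reach-suc k A u v)) r)
  ... | inj₁ r′ = shorter r′
  ... | inj₂ r′ with anyFin-elim m (extends k A u v) r′
  ... | e , ext with ∧-true _ _ ext
  ... | e∈A , ext′ with ∨-true _ _ ext′
  ... | inj₁ fwd = let (w , eq) = ∧-true _ _ fwd in forward e e∈A w (==-sound eq)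
  ... | inj₂ bwd = let (w , eq) = ∧-true _ _ bwd in backward e e∈A w (==-sound eq)

  reach-trans : ∀ a b A u x v → reach G a A u x ≡ true → reach G b A x v ≡ true → reach G (b + a) A u v ≡ true
  reach-trans a zero A u x v r₁ r₂ = subst (λ z → reach G a A u z ≡ true) (==-sound r₂) r₁
  reach-trans a (suc b) A u x v r₁ r₂ with lastStep b A x v r₂
  ... | shorter r = reach-step (b + a) A u v (reach-trans a b A u x v r₁ r)
  ... | forward e e∈A r refl = reach-edge₁ (b + a) A u e e∈A (reach-trans a b A u x (end₁ e) r₁ r)
  ... | backward e e∈A r refl = reach-edge₂ (b + a) A u e e∈A (reach-trans a b A u x (end₂ e) r₁ r)

  reach-sym : ∀ k A u v → reach G k A u v ≡ true → reach G k A v u ≡ true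
  reach-sym zero A u v r = subst (λ z → reach G 0 A z u ≡ true) (==-sound r) (reach-refl A u)
  reach-sym (suc k) A u v r with lastStep k A u v r
  ... | shorter r′ = reach-step k A v u (reach-sym k A u v r′)
  ... | forward e e∈A r′ refl = subst (λ i → reach G i A (end₂ e) u ≡ true) (NP.+-comm k 1)
          (reach-trans 1 k A (end₂ e) (end₁ e) u (reach-edge₂ 0 A (end₂ e) e e∈A (reach-refl A (end₂ e))) (reach-sym k A u (end₁ e) r′))
  ... | backward e e∈A r′ refl = subst (λ i → reach G i A (end₁ e) u ≡ true) (NP.+-comm k 1)
          (reach-trans 1 k A (end₁ e) (end₂ e) u (reach-edge₁ 0 A (end₁ e) e e∈A (reach-refl A (end₁ e))) (reach-sym k A u (end₂ e) r′))

  reach-suc-cong : ∀ k j A u → (∀ v → reach G k A u v ≡ reach G j A u v) →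
    ∀ v → reach G (suc k) A u v ≡ reach G (suc j) A u v
  reach-suc-cong k j A u same v = trans (reach-suc k A u v) (trans (cong₂ _∨_ (same v) (anyFin-cong m (λ e →
      cong (lookup A e ∧_) (cong₂ _∨_ (cong (_∧ (end₂ e == v)) (same (end₁ e))) (cong (_∧ (end₁ e == v)) (same (end₂ e)))))))
    (sym (reach-suc j A u v)))

  -- The sets reach k A u grow with k, strictly until they stabilise, and have
  -- at most n elements; hence walks of length ≤ n reach everything reachable.
  module Stabilisation (A : Vec Bool m) (u : Fin n) where
    R : ℕ → Fin n → Bool
    R k v = reach G k A u v

    Stable : ℕ → Set
    Stable k = ∀ v → R k v ≡ R (suc k) v

    stable-forever : ∀ k → Stable k → ∀ j v → R (j + k) v ≡ R k v
    stable-forever k st zero v = refl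
    stable-forever k st (suc j) v = trans (reach-suc-cong (j + k) k A u (stable-forever k st j) v) (sym (st v))

    stable-or-large : ∀ k → Σ ℕ (λ j → j ≤ k × Stable j) ⊎ (k < countFin n (R k))
    stable-or-large zero = inj₂ (countFin-pos n (R 0) u (reach-refl A u))
    stable-or-large (suc k) with stable-or-large k
    ... | inj₁ (j , j≤k , st) = inj₁ (j , NP.m≤n⇒m≤1+n j≤k , st)
    ... | inj₂ large with FP.all? {P = λ v → R k v ≡ R (suc k) v} (λ v → R k v BP.≟ R (suc k) v)
    ...   | yes st = inj₁ (k , NP.n≤1+n k , st)
    ...   | no unstable with FP.¬∀⟶∃¬ n (λ v → R k v ≡ R (suc k) v) (λ v → R k v BP.≟ R (suc k) v) unstable
    ...     | v , R≢ = let (old , new) = implies-≢ (R k v) (R (suc k) v) (reach-step k A u v) R≢ in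
                       inj₂ (NP.<-≤-trans (s≤s large) (countFin-strict n (R k) (R (suc k)) (reach-step k A u) v old new))

    stabilises : Σ ℕ (λ j → j ≤ n × Stable j)
    stabilises with stable-or-large n
    ... | inj₁ st = st
    ... | inj₂ large = ⊥-elim (NP.<-irrefl refl (NP.<-≤-trans large (countFin-≤ n (R n))))

    reach⇒connected : ∀ k v → R k v ≡ true → R n v ≡ true
    reach⇒connected k v r with stabilises
    ... | j , j≤n , st = reach-mono j≤n A u v
          (subst (_≡ true) (stable-forever j st ((n + k) ∸ j) v)
            (subst (λ i → R i v ≡ true) (sym (NP.m∸n+n≡m (NP.≤-trans j≤n (NP.m≤m+n n k))))
              (reach-mono (NP.m≤n+m k n) A u v r)))

  Conn : Vec Bool m → Fin n → Fin n → Set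
  Conn A u v = connected G A u v ≡ true

  conn-refl : ∀ A u → Conn A u u
  conn-refl A u = Stabilisation.reach⇒connected A u 0 u (reach-refl A u)

  conn-sym : ∀ A u v → Conn A u v → Conn A v u
  conn-sym A u v = reach-sym n A u v

  conn-trans : ∀ A u x v → Conn A u x → Conn A x v → Conn A u v
  conn-trans A u x v c₁ c₂ = Stabilisation.reach⇒connected A u (n + n) v (reach-trans n n A u x v c₁ c₂)

  conn-edge : ∀ A e → lookup A e ≡ true → Conn A (end₁ e) (end₂ e)
  conn-edge A e e∈A = Stabilisation.reach⇒connected A (end₁ e) 1 (end₂ e)
    (reach-edge₁ 0 A (end₁ e) e e∈A (reach-refl A (end₁ e)))

  reach-⊆ : ∀ k {A A′} → A′ ⊆ₑ A → ∀ u v → reach G k A′ u v ≡ true → reach G k A u v ≡ true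
  reach-⊆ zero A′⊆A u v r = r
  reach-⊆ (suc k) {A} {A′} A′⊆A u v r with lastStep k A′ u v r
  ... | shorter r′ = reach-step k A u v (reach-⊆ k A′⊆A u v r′)
  ... | forward e e∈A′ r′ refl = reach-edge₁ k A u e (A′⊆A e e∈A′) (reach-⊆ k A′⊆A u (end₁ e) r′)
  ... | backward e e∈A′ r′ refl = reach-edge₂ k A u e (A′⊆A e e∈A′) (reach-⊆ k A′⊆A u (end₂ e) r′)

  reach-constant : ∀ {k} (φ : Vec (Fin k) n) A → (∀ e → lookup A e ≡ true → lookup φ (end₁ e) ≡ lookup φ (end₂ e)) →
    ∀ j u v → reach G j A u v ≡ true → lookup φ u ≡ lookup φ v
  reach-constant φ A const zero u v r = cong (lookup φ) (==-sound r)
  reach-constant φ A const (suc j) u v r with lastStep j A u v r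
  ... | shorter r′ = reach-constant φ A const j u v r′
  ... | forward e e∈A r′ refl = trans (reach-constant φ A const j u (end₁ e) r′) (const e e∈A)
  ... | backward e e∈A r′ refl = trans (reach-constant φ A const j u (end₂ e) r′) (sym (const e e∈A))

countCol : ∀ k N → (Vec (Fin k) N → Bool) → ℕ
countCol k N p = ℕΣ.sumOver (ind ∘ p) (allVecs k N)

sumOver-allVecs-suc : ∀ k N (g : Vec (Fin k) (suc N) → ℕ) →
  ℕΣ.sumOver g (allVecs k (suc N)) ≡ sum (λ x → ℕΣ.sumOver (λ ψ → g (x ∷ ψ)) (allVecs k N))
sumOver-allVecs-suc k N g = trans (ℕΣ.sumOver-concatMap g (λ x → L.map (x ∷_) (allVecs k N)) (allFins k))
  (trans (ℕΣ.sumOver-cong (λ x → ℕΣ.sumOver-map g (x ∷_) (allVecs k N)) (allFins k))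
         (sumOver-allFins k _))

countCol-cong : ∀ k N {p q : Vec (Fin k) N → Bool} → (∀ φ → p φ ≡ q φ) → countCol k N p ≡ countCol k N q
countCol-cong k N p≡q = ℕΣ.sumOver-cong (λ φ → cong ind (p≡q φ)) (allVecs k N)

countCol-∧ : ∀ k N b (q : Vec (Fin k) N → Bool) → countCol k N (λ ψ → b ∧ q ψ) ≡ ind b * countCol k N q
countCol-∧ k N true q = sym (NP.+-identityʳ _)
countCol-∧ k N false q = ℕΣ.sumOver-zero (allVecs k N)

-- Acyclic constraint systems: each vertex of Fin N is either free, or its
-- colour is fixed, or it must copy the colour of an earlier vertex.

data Constraint (k N : ℕ) : Set where
  free : Constraint k N
  fixed : Fin k → Constraint k N
  copy : Fin N → Constraint k N

holds : ∀ {k N} → Constraint k N → Fin k → Vec (Fin k) N → Bool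
holds free x φ = true
holds (fixed a) x φ = x == a
holds (copy u) x φ = x == lookup φ u

isFree : ∀ {k N} → Constraint k N → Bool
isFree free = true
isFree (fixed _) = false
isFree (copy _) = false

satisfies : ∀ {k N} → (Fin N → Constraint k N) → Vec (Fin k) N → Bool
satisfies {N = N} cs φ = allFin N (λ v → holds (cs v) (lookup φ v) φ)

Acyclic : ∀ {k N} → (Fin N → Constraint k N) → Set
Acyclic cs = ∀ v u → cs v ≡ copy u → u F.< v

freeCount : ∀ {k N} → (Fin N → Constraint k N) → ℕ
freeCount {N = N} cs = countFin N (isFree ∘ cs)

-- once vertex 0 has colour x, a constraint on the remaining vertices
plug : ∀ {k N} → Fin k → Constraint k (suc N) → Constraint k N
plug x free = free
plug x (fixed a) = fixed a
plug x (copy zero) = fixed x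
plug x (copy (suc u)) = copy u

holds-plug : ∀ {k N} (c : Constraint k (suc N)) y x (ψ : Vec (Fin k) N) → holds c y (x ∷ ψ) ≡ holds (plug x c) y ψ
holds-plug free y x ψ = refl
holds-plug (fixed a) y x ψ = refl
holds-plug (copy zero) y x ψ = refl
holds-plug (copy (suc u)) y x ψ = refl

isFree-plug : ∀ {k N} (x : Fin k) (c : Constraint k (suc N)) → isFree (plug x c) ≡ isFree c
isFree-plug x free = refl
isFree-plug x (fixed a) = refl
isFree-plug x (copy zero) = refl
isFree-plug x (copy (suc u)) = refl

acyclic-plug : ∀ {k N} (cs : Fin (suc N) → Constraint k (suc N)) → Acyclic cs → ∀ x → Acyclic (λ v → plug x (cs (suc v)))
acyclic-plug cs acyc x v u eq with cs (suc v) in csv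
acyclic-plug cs acyc x v u refl | copy (suc u′) = NP.≤-pred (acyc (suc v) (suc u) csv)

count-solutions : ∀ k N (cs : Fin N → Constraint k N) → Acyclic cs → countCol k N (satisfies cs) ≡ k ^ freeCount cs
count-solutions k zero cs acyc = refl
count-solutions k (suc N) cs acyc =
  trans (sumOver-allVecs-suc k N (ind ∘ satisfies cs)) (by-first-constraint (cs zero) refl)
  where
  rest : Fin k → Fin N → Constraint k N
  rest x v = plug x (cs (suc v))

  freeCount-rest : ∀ x → freeCount (rest x) ≡ countFin N (isFree ∘ cs ∘ suc)
  freeCount-rest x = sum-cong-≗ {N} (λ v → cong ind (isFree-plug x (cs (suc v))))

  count-rest : ∀ x → countCol k N (satisfies (rest x)) ≡ k ^ countFin N (isFree ∘ cs ∘ suc)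
  count-rest x = trans (count-solutions k N (rest x) (acyclic-plug cs acyc x)) (cong (k ^_) (freeCount-rest x))

  split-first : ∀ {c} → cs zero ≡ c → ∀ x (ψ : Vec (Fin k) N) →
    satisfies cs (x ∷ ψ) ≡ holds c x (x ∷ ψ) ∧ satisfies (rest x) ψ
  split-first refl x ψ = cong (holds (cs zero) x (x ∷ ψ) ∧_)
    (allFin-cong N (λ v → holds-plug (cs (suc v)) (lookup ψ v) x ψ))

  by-first-constraint : ∀ c → cs zero ≡ c → sum (λ x → countCol k N (λ ψ → satisfies cs (x ∷ ψ))) ≡ k ^ freeCount cs
  by-first-constraint (copy u) cs₀ = ⊥-elim (NP.n≮0 (acyc zero u cs₀))
  by-first-constraint free cs₀ = begin
      sum (λ x → countCol k N (λ ψ → satisfies cs (x ∷ ψ)))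
        ≡⟨ sum-cong-≗ {k} (λ x → trans (countCol-cong k N (split-first cs₀ x)) (count-rest x)) ⟩
      sum {k} (λ _ → k ^ countFin N (isFree ∘ cs ∘ suc))
        ≡⟨ sum-const k _ ⟩
      k ^ suc (countFin N (isFree ∘ cs ∘ suc))
        ≡⟨ cong (λ c → k ^ (ind (isFree c) + countFin N (isFree ∘ cs ∘ suc))) (sym cs₀) ⟩
      k ^ freeCount cs ∎
    where open ≡-Reasoning
  by-first-constraint (fixed a) cs₀ = begin
      sum (λ x → countCol k N (λ ψ → satisfies cs (x ∷ ψ)))
        ≡⟨ sum-cong-≗ {k} (λ x → trans (countCol-cong k N (split-first cs₀ x))
                                  (trans (countCol-∧ k N (x == a) _) (cong (ind (x == a) *_) (count-rest x)))) ⟩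
      sum (λ x → ind (x == a) * k ^ countFin N (isFree ∘ cs ∘ suc))
        ≡⟨ sum-delta k a _ ⟩
      k ^ countFin N (isFree ∘ cs ∘ suc)
        ≡⟨ cong (λ c → k ^ (ind (isFree c) + countFin N (isFree ∘ cs ∘ suc))) (sym cs₀) ⟩
      k ^ freeCount cs ∎
    where open ≡-Reasoning

data Search {n : ℕ} (P : Fin n → Bool) : Set where
  found : ∀ w → P w ≡ true → Search P
  none : (∀ w → P w ≡ false) → Search P

search : ∀ {n} (P : Fin n → Bool) → Search P
search {n} P with anyFin n P in any-P
... | true = let (w , Pw) = anyFin-elim n P any-P in found w Pw
... | false = none (anyFin-false n P any-P)

module Components {n m : ℕ} (G : Multigraph n m) where
  open Connectivity G

  earlier : Vec Bool m → Fin n → Fin n → Bool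
  earlier A v w = ⌊ w F.<? v ⌋ ∧ connected G A v w

  isRoot : Vec Bool m → Fin n → Bool
  isRoot A v = not (any (earlier A v) (allFins n))

  c≡#roots : ∀ A → c G A ≡ countFin n (isRoot A)
  c≡#roots A = count-allFins n (isRoot A)

  root-if-none : ∀ A v → (∀ w → earlier A v w ≡ false) → isRoot A v ≡ true
  root-if-none A v nothing = cong not (trans (any-allFins n (earlier A v)) (anyFin-none n (earlier A v) nothing))

  nonRoot-if-found : ∀ A v w → earlier A v w ≡ true → isRoot A v ≡ false
  nonRoot-if-found A v w w-earlier = cong not (trans (any-allFins n (earlier A v)) (anyFin-intro n (earlier A v) w w-earlier))

  nonRoot⇒earlier : ∀ A v → isRoot A v ≡ false → Σ (Fin n) (λ w → w F.< v × Conn A v w)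
  nonRoot⇒earlier A v notRoot with search (earlier A v)
  ... | found w hw = let (w<v , conn) = ∧-true _ _ hw in w , <?-sound w<v , conn
  ... | none nothing = ⊥-elim (false≢true (trans (sym notRoot) (root-if-none A v nothing)))

  root⇒¬earlier : ∀ A v → isRoot A v ≡ true → ∀ w → w F.< v → Conn A v w → ⊥
  root⇒¬earlier A v root w w<v conn =
    false≢true (trans (sym (nonRoot-if-found A v w (∧-intro _ _ (<?-complete w<v) conn))) root)

  roots-unique : ∀ A x y → isRoot A x ≡ true → isRoot A y ≡ true → Conn A x y → x ≡ y
  roots-unique A x y rx ry conn with FP.<-cmp x y
  ... | tri< x<y _ _ = ⊥-elim (root⇒¬earlier A y ry x x<y (conn-sym A x y conn))
  ... | tri≈ _ x≡y _ = x≡y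
  ... | tri> _ _ y<x = ⊥-elim (root⇒¬earlier A x rx y y<x conn)

module ConstantColourings {n m : ℕ} (G : Multigraph n m) where
  open Connectivity G
  open Components G

  constantOn : ∀ {k} → Vec Bool m → Vec (Fin k) n → Bool
  constantOn A φ = allFin m (λ e → not (lookup A e) ∨ (lookup φ (end₁ e) == lookup φ (end₂ e)))

  constantOn-edge : ∀ {k} A (φ : Vec (Fin k) n) → constantOn A φ ≡ true →
    ∀ e → lookup A e ≡ true → lookup φ (end₁ e) ≡ lookup φ (end₂ e)
  constantOn-edge A φ const e e∈A = ==-sound
    (subst (λ b → not b ∨ (lookup φ (end₁ e) == lookup φ (end₂ e)) ≡ true) e∈A (allFin-elim m _ const e))

  constantOn-intro : ∀ {k} A (φ : Vec (Fin k) n) →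
    (∀ e → lookup A e ≡ true → lookup φ (end₁ e) ≡ lookup φ (end₂ e)) → constantOn A φ ≡ true
  constantOn-intro A φ same = allFin-intro m _ edge
    where
    edge : ∀ e → not (lookup A e) ∨ (lookup φ (end₁ e) == lookup φ (end₂ e)) ≡ true
    edge e with lookup A e in e∈A
    ... | false = refl
    ... | true rewrite same e e∈A = ==-refl _

  -- Constant colourings solve an acyclic system: roots are free, every
  -- other vertex copies the colour of an earlier vertex of its component.
  rootConstraint : ∀ {k v} {A : Vec Bool m} → Search (earlier A v) → Constraint k n
  rootConstraint (found w _) = copy w
  rootConstraint (none _) = free

  rootSystem : ∀ {k} → Vec Bool m → Fin n → Constraint k n
  rootSystem A v = rootConstraint (search (earlier A v))

  rootSystem-acyclic : ∀ {k} A → Acyclic {k} (rootSystem A)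
  rootSystem-acyclic {k} A v u = acyclic (search (earlier A v))
    where
    acyclic : (s : Search (earlier A v)) → rootConstraint {k} s ≡ copy u → u F.< v
    acyclic (found w hw) refl = <?-sound (proj₁ (∧-true _ _ hw))

  rootSystem-free : ∀ {k} A → freeCount {k} (rootSystem A) ≡ c G A
  rootSystem-free {k} A = sym (trans (c≡#roots A) (sum-cong-≗ {n} (λ v → cong ind (free≡root v (search (earlier A v))))))
    where
    free≡root : ∀ v (s : Search (earlier A v)) → isRoot A v ≡ isFree (rootConstraint {k} s)
    free≡root v (found w hw) = nonRoot-if-found A v w hw
    free≡root v (none nothing) = root-if-none A v nothing

  constant⇒solution : ∀ {k} A (φ : Vec (Fin k) n) → constantOn A φ ≡ true → satisfies (rootSystem A) φ ≡ true
  constant⇒solution {k} A φ const = allFin-intro n _ (λ v → holds-at v (search (earlier A v)))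
    where
    holds-at : ∀ v (s : Search (earlier A v)) → holds (rootConstraint {k} s) (lookup φ v) φ ≡ true
    holds-at v (found w hw) = subst (λ z → (lookup φ v == z) ≡ true)
      (reach-constant φ A (constantOn-edge A φ const) n v w (proj₂ (∧-true _ _ hw))) (==-refl (lookup φ v))
    holds-at v (none _) = refl

  module _ {k} (A : Vec Bool m) (φ : Vec (Fin k) n) (sol : satisfies (rootSystem A) φ ≡ true) where
    -- in a solution every vertex has the colour of some root of its component
    -- (recursion along the copy pointers, which decrease; fuel bounds v)
    colour-of-root : ∀ fuel v → toℕ v < fuel → Σ (Fin n) (λ r → isRoot A r ≡ true × Conn A v r × lookup φ v ≡ lookup φ r)
    colour-of-root (suc fuel) v v<fuel with search (earlier A v) | allFin-elim n _ sol v
    ... | found w hw | copies with colour-of-root fuel w (NP.<-≤-trans (<?-sound (proj₁ (∧-true _ _ hw))) (NP.≤-pred v<fuel))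
    ...   | r , root , w~r , φw≡φr = r , root , conn-trans A v w r (proj₂ (∧-true _ _ hw)) w~r , trans (==-sound copies) φw≡φr
    colour-of-root (suc fuel) v v<fuel | none nothing | _ = v , root-if-none A v nothing , conn-refl A v , refl

    solution⇒constant : constantOn A φ ≡ true
    solution⇒constant = constantOn-intro A φ same
      where
      same : ∀ e → lookup A e ≡ true → lookup φ (end₁ e) ≡ lookup φ (end₂ e)
      same e e∈A with colour-of-root _ (end₁ e) NP.≤-refl | colour-of-root _ (end₂ e) NP.≤-refl
      ... | r₁ , root₁ , c₁ , φ₁ | r₂ , root₂ , c₂ , φ₂ =
        trans φ₁ (trans (cong (lookup φ) r₁≡r₂) (sym φ₂))
        where
        r₁≡r₂ = roots-unique A r₁ r₂ root₁ root₂
          (conn-trans A r₁ (end₁ e) r₂ (conn-sym A (end₁ e) r₁ c₁) (conn-trans A (end₁ e) (end₂ e) r₂ (conn-edge A e e∈A) c₂))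

  count-constant : ∀ k A → countCol k n (constantOn A) ≡ k ^ c G A
  count-constant k A = begin
      countCol k n (constantOn A)
        ≡⟨ countCol-cong k n (λ φ → bool-ext (constant⇒solution A φ) (solution⇒constant A φ)) ⟩
      countCol k n (satisfies (rootSystem A))
        ≡⟨ count-solutions k n (rootSystem A) (rootSystem-acyclic A) ⟩
      k ^ freeCount (rootSystem {k} A)
        ≡⟨ cong (k ^_) (rootSystem-free A) ⟩
      k ^ c G A ∎
    where open ≡-Reasoning

size-≤ : ∀ {m} (A : Vec Bool m) → size A ≤ m
size-≤ [] = z≤n
size-≤ (true ∷ A) = s≤s (size-≤ A)
size-≤ (false ∷ A) = NP.m≤n⇒m≤1+n (size-≤ A)

size-allEdges : ∀ m → size (allEdges m) ≡ m
size-allEdges zero = refl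
size-allEdges (suc m) = cong suc (size-allEdges m)

⊆-allEdges : ∀ {m} (A : Vec Bool m) → A ⊆ₑ allEdges m
⊆-allEdges A e _ = VP.lookup-replicate e true

size-delete : ∀ {m} (A : Vec Bool m) e → lookup A e ≡ true → suc (size (A V.[ e ]≔ false)) ≡ size A
size-delete (true ∷ A) zero e∈A = refl
size-delete (true ∷ A) (suc e) e∈A = cong suc (size-delete A e e∈A)
size-delete (false ∷ A) (suc e) e∈A = size-delete A e e∈A

delete-⊆ : ∀ {m} (A : Vec Bool m) e → (A V.[ e ]≔ false) ⊆ₑ A
delete-⊆ A e f f∈A′ with f FP.≟ e
... | yes refl = ⊥-elim (false≢true (trans (sym (VP.lookup∘updateAt e A)) f∈A′))
... | no f≢e = trans (sym (VP.lookup∘updateAt′ f e f≢e A)) f∈A′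

some-edge : ∀ {m} (A : Vec Bool m) s → size A ≡ suc s → Σ (Fin m) (λ e → lookup A e ≡ true)
some-edge (true ∷ A) s _ = zero , refl
some-edge (false ∷ A) s |A| = let (e , e∈A) = some-edge A s |A| in suc e , e∈A

no-edges : ∀ {m} (A : Vec Bool m) → size A ≡ 0 → ∀ e → lookup A e ≡ false
no-edges (false ∷ A) |A| zero = refl
no-edges (false ∷ A) |A| (suc e) = no-edges A |A| e

-- Bounds on the number of components, c(E) ≤ c(A) ≤ n and n ≤ |A| + c(A)
-- (i.e. r(A) ≤ |A|): they make the truncated subtractions in the Tutte exponents exact.

module ComponentBounds {n m : ℕ} (G : Multigraph n m) where
  open Connectivity G
  open Components G

  c≤n : ∀ A → c G A ≤ n
  c≤n A = subst (_≤ n) (sym (c≡#roots A)) (countFin-≤ n (isRoot A))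

  -- removing edges keeps roots roots, so it can only increase c
  root-antitone : ∀ {A A′} → A′ ⊆ₑ A → ∀ v → isRoot A v ≡ true → isRoot A′ v ≡ true
  root-antitone {A} {A′} A′⊆A v root with isRoot A′ v in root′
  ... | true = refl
  ... | false = let (w , w<v , conn) = nonRoot⇒earlier A′ v root′ in
                ⊥-elim (root⇒¬earlier A v root w w<v (reach-⊆ n A′⊆A v w conn))

  c-antitone : ∀ {A A′} → A′ ⊆ₑ A → c G A ≤ c G A′
  c-antitone {A} {A′} A′⊆A = subst₂ _≤_ (sym (c≡#roots A)) (sym (c≡#roots A′))
    (countFin-mono n (isRoot A) (isRoot A′) (root-antitone A′⊆A))

  cG≤c : ∀ A → cG G ≤ c G A
  cG≤c A = c-antitone (⊆-allEdges A)

  c-edgeless : ∀ A → (∀ e → lookup A e ≡ false) → n ≤ c G A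
  c-edgeless A edgeless = subst₂ _≤_ (countFin-true n) (sym (c≡#roots A))
    (countFin-mono n (λ _ → true) (isRoot A) (λ v _ → every-root v))
    where
    trivial-walk : ∀ k u v → reach G k A u v ≡ true → u ≡ v
    trivial-walk zero u v r = ==-sound r
    trivial-walk (suc k) u v r with lastStep k A u v r
    ... | shorter r′ = trivial-walk k u v r′
    ... | forward e e∈A _ _ = ⊥-elim (false≢true (trans (sym (edgeless e)) e∈A))
    ... | backward e e∈A _ _ = ⊥-elim (false≢true (trans (sym (edgeless e)) e∈A))
    every-root : ∀ v → isRoot A v ≡ true
    every-root v with isRoot A v in root
    ... | true = refl
    ... | false = let (w , w<v , conn) = nonRoot⇒earlier A v root in
                  ⊥-elim (NP.<-irrefl (cong toℕ (sym (trivial-walk n v w conn))) w<v)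

  module DeleteEdge (A : Vec Bool m) (e : Fin m) (e∈A : lookup A e ≡ true) where
    A′ : Vec Bool m
    A′ = A V.[ e ]≔ false

    a b : Fin n
    a = end₁ e
    b = end₂ e

    -- how x, y connected in A are connected in A′: directly, or through e
    ViaEdge : Fin n → Fin n → Set
    ViaEdge x y = Conn A′ x y ⊎ ((Conn A′ x a × Conn A′ b y) ⊎ (Conn A′ x b × Conn A′ a y))

    via-extend : ∀ x z y → ViaEdge x z → Conn A′ z y → ViaEdge x y
    via-extend x z y (inj₁ c₁) c = inj₁ (conn-trans A′ x z y c₁ c)
    via-extend x z y (inj₂ (inj₁ (c₁ , c₂))) c = inj₂ (inj₁ (c₁ , conn-trans A′ b z y c₂ c))
    via-extend x z y (inj₂ (inj₂ (c₁ , c₂))) c = inj₂ (inj₂ (c₁ , conn-trans A′ a z y c₂ c))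

    via-cross : ∀ x → ViaEdge x a → ViaEdge x b
    via-cross x (inj₁ c₁) = inj₂ (inj₁ (c₁ , conn-refl A′ b))
    via-cross x (inj₂ (inj₁ (c₁ , _))) = inj₂ (inj₁ (c₁ , conn-refl A′ b))
    via-cross x (inj₂ (inj₂ (c₁ , _))) = inj₁ c₁

    via-cross⁻¹ : ∀ x → ViaEdge x b → ViaEdge x a
    via-cross⁻¹ x (inj₁ c₁) = inj₂ (inj₂ (c₁ , conn-refl A′ a))
    via-cross⁻¹ x (inj₂ (inj₁ (c₁ , _))) = inj₁ c₁
    via-cross⁻¹ x (inj₂ (inj₂ (c₁ , _))) = inj₂ (inj₂ (c₁ , conn-refl A′ a))

    walk-via-edge : ∀ k x y → reach G k A x y ≡ true → ViaEdge x y
    walk-via-edge zero x y r = inj₁ (subst (Conn A′ x) (==-sound r) (conn-refl A′ x))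
    walk-via-edge (suc k) x y r with lastStep k A x y r
    ... | shorter r′ = walk-via-edge k x y r′
    ... | forward f f∈A r′ refl with f FP.≟ e
    ...   | yes refl = via-cross x (walk-via-edge k x a r′)
    ...   | no f≢e = via-extend x (end₁ f) (end₂ f) (walk-via-edge k x (end₁ f) r′)
                       (conn-edge A′ f (trans (VP.lookup∘updateAt′ f e f≢e A) f∈A))
    walk-via-edge (suc k) x y r | backward f f∈A r′ refl with f FP.≟ e
    ...   | yes refl = via-cross⁻¹ x (walk-via-edge k x b r′)
    ...   | no f≢e = via-extend x (end₂ f) (end₁ f) (walk-via-edge k x (end₂ f) r′)
                       (conn-sym A′ (end₁ f) (end₂ f) (conn-edge A′ f (trans (VP.lookup∘updateAt′ f e f≢e A) f∈A)))

    -- A new root v (root in A′ but not in A) lies on one side of e while an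
    -- earlier vertex lies on the other; two new roots v₁ < v₂ would make an
    -- earlier vertex A′-connected to v₂.
    no-two-new-roots : ∀ v₁ v₂ → v₁ F.< v₂ → isRoot A′ v₁ ≡ true → isRoot A v₁ ≡ false →
      isRoot A′ v₂ ≡ true → isRoot A v₂ ≡ false → ⊥
    no-two-new-roots v₁ v₂ v₁<v₂ root₁′ old₁ root₂′ old₂
      with nonRoot⇒earlier A v₁ old₁ | nonRoot⇒earlier A v₂ old₂
    ... | w₁ , w₁<v₁ , c₁ | w₂ , w₂<v₂ , c₂ with walk-via-edge n v₁ w₁ c₁ | walk-via-edge n v₂ w₂ c₂
    ... | _ | inj₁ direct = root⇒¬earlier A′ v₂ root₂′ w₂ w₂<v₂ direct
    ... | inj₁ direct | _ = root⇒¬earlier A′ v₁ root₁′ w₁ w₁<v₁ direct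
    ... | inj₂ (inj₁ (v₁a , _)) | inj₂ (inj₁ (v₂a , _)) =
          root⇒¬earlier A′ v₂ root₂′ v₁ v₁<v₂ (conn-trans A′ v₂ a v₁ v₂a (conn-sym A′ v₁ a v₁a))
    ... | inj₂ (inj₂ (_ , aw₁)) | inj₂ (inj₁ (v₂a , _)) =
          root⇒¬earlier A′ v₂ root₂′ w₁ (FP.<-trans w₁<v₁ v₁<v₂) (conn-trans A′ v₂ a w₁ v₂a aw₁)
    ... | inj₂ (inj₁ (_ , bw₁)) | inj₂ (inj₂ (v₂b , _)) =
          root⇒¬earlier A′ v₂ root₂′ w₁ (FP.<-trans w₁<v₁ v₁<v₂) (conn-trans A′ v₂ b w₁ v₂b bw₁)
    ... | inj₂ (inj₂ (v₁b , _)) | inj₂ (inj₂ (v₂b , _)) =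
          root⇒¬earlier A′ v₂ root₂′ v₁ v₁<v₂ (conn-trans A′ v₂ b v₁ v₂b (conn-sym A′ v₁ b v₁b))

    new-root-unique : ∀ x y → isRoot A′ x ≡ true → isRoot A x ≡ false → isRoot A′ y ≡ true → isRoot A y ≡ false → x ≡ y
    new-root-unique x y rx′ rx ry′ ry with FP.<-cmp x y
    ... | tri< x<y _ _ = ⊥-elim (no-two-new-roots x y x<y rx′ rx ry′ ry)
    ... | tri≈ _ x≡y _ = x≡y
    ... | tri> _ _ y<x = ⊥-elim (no-two-new-roots y x y<x ry′ ry rx′ rx)

    c-delete : c G A′ ≤ suc (c G A)
    c-delete = subst₂ (λ p q → p ≤ suc q) (sym (c≡#roots A′)) (sym (c≡#roots A))
      (countFin-≤-suc n (isRoot A′) (isRoot A) (root-antitone (delete-⊆ A e)) new-root-unique)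

  -- r(A) ≤ |A|, by deleting the edges of A one at a time
  rank≤size : ∀ A → n ≤ size A + c G A
  rank≤size A = by-size (size A) A refl
    where
    by-size : ∀ s A → size A ≡ s → n ≤ size A + c G A
    by-size zero A |A| = NP.≤-trans (c-edgeless A (no-edges A |A|)) (NP.m≤n+m _ (size A))
    by-size (suc s) A |A| with some-edge A s |A|
    ... | e , e∈A = begin
        n                                 ≤⟨ by-size s A′ (NP.suc-injective (trans (size-delete A e e∈A) |A|)) ⟩
        size A′ + c G A′                  ≤⟨ NP.+-monoʳ-≤ (size A′) (DeleteEdge.c-delete A e e∈A) ⟩
        size A′ + suc (c G A)             ≡⟨ NP.+-suc (size A′) (c G A) ⟩
        suc (size A′) + c G A             ≡⟨ cong (_+ c G A) (size-delete A e e∈A) ⟩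
        size A + c G A                    ∎
      where
      open NP.≤-Reasoning
      A′ = A V.[ e ]≔ false

countCol-++ : ∀ k N M (p : Vec (Fin k) (N + M) → Bool) →
  countCol k (N + M) p ≡ ℕΣ.sumOver (λ φ → countCol k M (λ ψ → p (φ V.++ ψ))) (allVecs k N)
countCol-++ k zero M p = sym (NP.+-identityʳ _)
countCol-++ k (suc N) M p = trans (sumOver-allVecs-suc k (N + M) (ind ∘ p))
  (trans (sum-cong-≗ {k} (λ x → countCol-++ k N M (λ ψ → p (x ∷ ψ))))
         (sym (sumOver-allVecs-suc k N (λ φ → countCol k M (λ ψ → p (φ V.++ ψ))))))

countCol-independent : ∀ k M (Q : Fin M → Fin k → Bool) →
  countCol k M (λ ψ → allFin M (λ e → Q e (lookup ψ e))) ≡ ℕΣ.prodFin M (λ e → countFin k (Q e))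
countCol-independent k zero Q = refl
countCol-independent k (suc M) Q = trans (sumOver-allVecs-suc k M _)
  (trans (sum-cong-≗ {k} (λ x → trans (countCol-∧ k M (Q zero x) _) (cong (ind (Q zero x) *_) (countCol-independent k M (Q ∘ suc)))))
         (sym (*-distribʳ-sum _ (ind ∘ Q zero))))

notMonochromatic : ∀ {k} → Fin k → Fin k → Fin k → Bool
notMonochromatic a b x = any (λ y → any (λ z → not (y == z)) (a ∷ b ∷ x ∷ [])) (a ∷ b ∷ x ∷ [])

-- the number of colours available for w_e when its ends have colours a, b
weight : ∀ {k} → Fin k → Fin k → ℕ
weight {k} a b = if a == b then k ∸ 1 else k

count-third-colour : ∀ k (a b : Fin k) → countFin k (notMonochromatic a b) ≡ weight a b
count-third-colour k a b = by-cases (a FP.≟ b)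
  where
  same-ends : ∀ x → notMonochromatic a a x ≡ not (a == x)
  same-ends x with a FP.≟ x
  ... | yes refl rewrite ==-refl a = refl
  ... | no _ rewrite ==-refl a = refl

  count-other : ∀ k (a : Fin k) → countFin k (λ x → not (a == x)) ≡ k ∸ 1
  count-other (suc k) zero rewrite ==-refl (zero {k}) =
    trans (sum-cong-≗ {k} (λ x → cong (ind ∘ not) (≢⇒==-false {x = zero} {suc x} (λ ())))) (countFin-true k)
  count-other (suc (suc k)) (suc a) rewrite ≢⇒==-false {x = suc a} {zero {suc k}} (λ ()) =
    cong suc (trans (sum-cong-≗ {suc k} (λ x → cong (ind ∘ not) (==-suc a x))) (count-other (suc k) a))

  by-cases : Dec (a ≡ b) → countFin k (notMonochromatic a b) ≡ weight a b
  by-cases (yes refl) = trans (sum-cong-≗ {k} (λ x → cong ind (same-ends x)))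
    (trans (count-other k a) (cong (λ t → if t then k ∸ 1 else k) (sym (==-refl a))))
  by-cases (no a≢b) = trans (sum-cong-≗ {k} (λ x → cong ind (different-ends x)))
    (trans (countFin-true k) (cong (λ t → if t then k ∸ 1 else k) (sym (≢⇒==-false a≢b))))
    where
    different-ends : ∀ x → notMonochromatic a b x ≡ true
    different-ends x rewrite ==-refl a | ≢⇒==-false a≢b = refl

module ChromaticSum {n m : ℕ} (G : Multigraph n m) where
  open Connectivity G

  extensions : ∀ {k} → Vec (Fin k) n → ℕ
  extensions φ = ℕΣ.prodFin m (λ e → weight (lookup φ (end₁ e)) (lookup φ (end₂ e)))

  weakProper-split : ∀ {k} (φ : Vec (Fin k) n) (ψ : Vec (Fin k) m) →
    isWeakProper (HG G) (φ V.++ ψ) ≡ allFin m (λ e → notMonochromatic (lookup φ (end₁ e)) (lookup φ (end₂ e)) (lookup ψ e))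
  weakProper-split φ ψ = trans (cong and (sym (LP.map-∘ (allFins m)))) (trans (all-allFins m _) (allFin-cong m edge))
    where
    edge : ∀ e → let (u , v) = ends G e in
      notMonochromatic (lookup (φ V.++ ψ) (u ↑ˡ m)) (lookup (φ V.++ ψ) (v ↑ˡ m)) (lookup (φ V.++ ψ) (n ↑ʳ e))
        ≡ notMonochromatic (lookup φ (end₁ e)) (lookup φ (end₂ e)) (lookup ψ e)
    edge e rewrite VP.lookup-++ˡ φ ψ (end₁ e) | VP.lookup-++ˡ φ ψ (end₂ e) | VP.lookup-++ʳ φ ψ e = refl

  chromPoly-as-sum : ∀ k → chromPoly (HG G) k ≡ ℕΣ.sumOver extensions (allVecs k n)
  chromPoly-as-sum k = begin
      chromPoly (HG G) k
        ≡⟨ count-as-sum (isWeakProper (HG G)) (allVecs k (n + m)) ⟩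
      countCol k (n + m) (isWeakProper (HG G))
        ≡⟨ countCol-++ k n m (isWeakProper (HG G)) ⟩
      ℕΣ.sumOver (λ φ → countCol k m (λ ψ → isWeakProper (HG G) (φ V.++ ψ))) (allVecs k n)
        ≡⟨ ℕΣ.sumOver-cong (λ φ → trans (countCol-cong k m (weakProper-split φ)) (extend φ)) (allVecs k n) ⟩
      ℕΣ.sumOver extensions (allVecs k n) ∎
    where
    open ≡-Reasoning
    extend : ∀ φ → countCol k m (λ ψ → allFin m (λ e → notMonochromatic (lookup φ (end₁ e)) (lookup φ (end₂ e)) (lookup ψ e)))
                     ≡ extensions φ
    extend φ = trans (countCol-independent k m (λ e → notMonochromatic (lookup φ (end₁ e)) (lookup φ (end₂ e))))
                     (ℕΣ.prodFin-cong m (λ e → count-third-colour k _ _))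

ι : ℤ → ℚ
ι z = z ℚ./ 1

-- ι is computed through unnormalised rationals, where ι z = z / 1 is literal
ι-as-ℚᵘ : ∀ z → ℚ.toℚᵘ (ι z) U.≃ U.mkℚᵘ z 0
ι-as-ℚᵘ z = QP.toℚᵘ-fromℚᵘ (U.mkℚᵘ z 0)

ι-+ : ∀ a b → ι (a ℤ.+ b) ≡ ι a ℚ.+ ι b
ι-+ a b = QP.toℚᵘ-injective (UP.≃-trans (ι-as-ℚᵘ (a ℤ.+ b)) (UP.≃-trans ᵘ-+
  (UP.≃-sym (UP.≃-trans (QP.toℚᵘ-homo-+ (ι a) (ι b)) (UP.+-cong (ι-as-ℚᵘ a) (ι-as-ℚᵘ b))))))
  where
  open ZS
  ᵘ-+ : U.mkℚᵘ (a ℤ.+ b) 0 U.≃ (U.mkℚᵘ a 0 U.+ U.mkℚᵘ b 0)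
  ᵘ-+ = U.*≡* (solve 2 (λ a b → (a :+ b) :* con (ℤ.+ 1) := (a :* con (ℤ.+ 1) :+ b :* con (ℤ.+ 1)) :* con (ℤ.+ 1)) refl a b)

ι-* : ∀ a b → ι (a ℤ.* b) ≡ ι a ℚ.* ι b
ι-* a b = QP.toℚᵘ-injective (UP.≃-trans (ι-as-ℚᵘ (a ℤ.* b)) (UP.≃-trans ᵘ-*
  (UP.≃-sym (UP.≃-trans (QP.toℚᵘ-homo-* (ι a) (ι b)) (UP.*-cong (ι-as-ℚᵘ a) (ι-as-ℚᵘ b))))))
  where
  open ZS
  ᵘ-* : U.mkℚᵘ (a ℤ.* b) 0 U.≃ (U.mkℚᵘ a 0 U.* U.mkℚᵘ b 0)
  ᵘ-* = U.*≡* (solve 2 (λ a b → (a :* b) :* con (ℤ.+ 1) := (a :* b) :* con (ℤ.+ 1)) refl a b)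

/-*-cancel : ∀ z d → (z ℚ./ suc d) ℚ.* ι (ℤ.+ suc d) ≡ ι z
/-*-cancel z d = QP.toℚᵘ-injective (UP.≃-trans (QP.toℚᵘ-homo-* (z ℚ./ suc d) (ι (ℤ.+ suc d)))
  (UP.≃-trans (UP.*-cong (QP.toℚᵘ-fromℚᵘ (U.mkℚᵘ z d)) (ι-as-ℚᵘ (ℤ.+ suc d)))
    (UP.≃-trans (U.*≡* cross) (UP.≃-sym (ι-as-ℚᵘ z)))))
  where
  cross : (z ℤ.* ℤ.+ suc d) ℤ.* ℤ.+ 1 ≡ z ℤ.* ℤ.+ suc (d ℕ.* 1)
  cross rewrite NP.*-identityʳ d = ZP.*-identityʳ _

ℕtoℚ-+ : ∀ a b → ℕtoℚ (a + b) ≡ ℕtoℚ a ℚ.+ ℕtoℚ b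
ℕtoℚ-+ a b = trans (cong ι (ZP.pos-+ a b)) (ι-+ (ℤ.+ a) (ℤ.+ b))

ℕtoℚ-* : ∀ a b → ℕtoℚ (a * b) ≡ ℕtoℚ a ℚ.* ℕtoℚ b
ℕtoℚ-* a b = trans (cong ι (ZP.pos-* a b)) (ι-* (ℤ.+ a) (ℤ.+ b))

ℕtoℚ-^ : ∀ k j → ℕtoℚ (k ^ j) ≡ ℕtoℚ k ^ℚ j
ℕtoℚ-^ k zero = refl
ℕtoℚ-^ k (suc j) = trans (ℕtoℚ-* k (k ^ j)) (cong (ℕtoℚ k ℚ.*_) (ℕtoℚ-^ k j))

ℕtoℚ-sum : {A : Set} (f : A → ℕ) (xs : List A) → ℕtoℚ (ℕΣ.sumOver f xs) ≡ ℚΣ.sumOver (ℕtoℚ ∘ f) xs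
ℕtoℚ-sum f [] = refl
ℕtoℚ-sum f (x ∷ xs) = trans (ℕtoℚ-+ (f x) _) (cong (ℕtoℚ (f x) ℚ.+_) (ℕtoℚ-sum f xs))

ℕtoℚ-prod : ∀ m (f : Fin m → ℕ) → ℕtoℚ (ℕΣ.prodFin m f) ≡ ℚΣ.prodFin m (ℕtoℚ ∘ f)
ℕtoℚ-prod zero f = refl
ℕtoℚ-prod (suc m) f = trans (ℕtoℚ-* (f zero) _) (cong (ℕtoℚ (f zero) ℚ.*_) (ℕtoℚ-prod m (f ∘ suc)))

^-+ : ∀ x i j → x ^ℚ (i + j) ≡ x ^ℚ i ℚ.* x ^ℚ j
^-+ x zero j = sym (QP.*-identityˡ _)
^-+ x (suc i) j = trans (cong (x ℚ.*_) (^-+ x i j)) (sym (QP.*-assoc x _ _))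

^-* : ∀ x y i → (x ℚ.* y) ^ℚ i ≡ x ^ℚ i ℚ.* y ^ℚ i
^-* x y zero = refl
^-* x y (suc i) = trans (cong ((x ℚ.* y) ℚ.*_) (^-* x y i))
  (solve 4 (λ x y a b → (x :* y) :* (a :* b) := (x :* a) :* (y :* b)) refl x y (x ^ℚ i) (y ^ℚ i))
  where open QS

-1ℚ : ℚ
-1ℚ = ℚ.- 1ℚ

-1^-square : ∀ i → -1ℚ ^ℚ i ℚ.* -1ℚ ^ℚ i ≡ 1ℚ
-1^-square zero = refl
-1^-square (suc i) = begin
    (-1ℚ ℚ.* p) ℚ.* (-1ℚ ℚ.* p) ≡⟨ solve 2 (λ m p → (m :* p) :* (m :* p) := (m :* m) :* (p :* p)) refl -1ℚ p ⟩
    (-1ℚ ℚ.* -1ℚ) ℚ.* (p ℚ.* p)  ≡⟨ QP.*-identityˡ (p ℚ.* p) ⟩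
    p ℚ.* p                      ≡⟨ -1^-square i ⟩
    1ℚ                           ∎
  where
  open ≡-Reasoning
  open QS
  p = -1ℚ ^ℚ i

-- the correction −[b] in the weight λ − [φ(u_e) = φ(v_e)]
negInd : Bool → ℚ
negInd b = if b then -1ℚ else ℚ.0ℚ

ℕtoℚ-weight : ∀ {k} (a b : Fin k) → ℕtoℚ (weight a b) ≡ ℕtoℚ k ℚ.+ negInd (a == b)
ℕtoℚ-weight {suc l} a b with a == b
... | false = sym (QP.+-identityʳ _)
... | true = begin
    ℕtoℚ l                                 ≡⟨ solve 2 (λ x o → x := (o :+ x) :- o) refl (ℕtoℚ l) 1ℚ ⟩
    (1ℚ ℚ.+ ℕtoℚ l) ℚ.- 1ℚ                 ≡⟨ cong (ℚ._- 1ℚ) (sym (ℕtoℚ-+ 1 l)) ⟩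
    ℕtoℚ (suc l) ℚ.+ -1ℚ                   ∎
  where
  open ≡-Reasoning
  open QS

subset-product : ∀ (L : ℚ) m (A : Vec Bool m) (M : Fin m → Bool) →
  ℚΣ.prodFin m (λ e → if lookup A e then negInd (M e) else L)
    ≡ ℕtoℚ (ind (allFin m (λ e → not (lookup A e) ∨ M e))) ℚ.* (-1ℚ ^ℚ size A ℚ.* L ^ℚ (m ∸ size A))
subset-product L zero [] M = refl
subset-product L (suc m) (true ∷ A) M with M zero
... | true rewrite subset-product L m A (M ∘ suc) =
  solve 3 (λ i s l → con -1ℚ :* (i :* (s :* l)) := i :* ((con -1ℚ :* s) :* l)) refl
    (ℕtoℚ (ind (allFin m (λ e → not (lookup A e) ∨ M (suc e))))) (-1ℚ ^ℚ size A) (L ^ℚ (m ∸ size A))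
  where open QS
... | false = trans (QP.*-zeroˡ (ℚΣ.prodFin m (λ e → if lookup A e then negInd (M (suc e)) else L)))
                   (sym (QP.*-zeroˡ (-1ℚ ^ℚ suc (size A) ℚ.* L ^ℚ (m ∸ size A))))
subset-product L (suc m) (false ∷ A) M rewrite subset-product L m A (M ∘ suc) | NP.+-∸-assoc 1 (size-≤ A) =
  solve 4 (λ L i s l → L :* (i :* (s :* l)) := i :* (s :* (L :* l))) refl
    L (ℕtoℚ (ind (allFin m (λ e → not (lookup A e) ∨ M (suc e))))) (-1ℚ ^ℚ size A) (L ^ℚ (m ∸ size A))
  where open QS

sum-indicator : {A : Set} (p : A → Bool) (t : ℚ) (xs : List A) →
  ℚΣ.sumOver (λ x → ℕtoℚ (ind (p x)) ℚ.* t) xs ≡ ℕtoℚ (ℕΣ.sumOver (ind ∘ p) xs) ℚ.* t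
sum-indicator p t xs = begin
    ℚΣ.sumOver (λ x → ℕtoℚ (ind (p x)) ℚ.* t) xs ≡⟨ ℚΣ.sumOver-cong (λ x → QP.*-comm _ t) xs ⟩
    ℚΣ.sumOver (λ x → t ℚ.* ℕtoℚ (ind (p x))) xs ≡⟨ ℚΣ.sumOver-*ˡ t (ℕtoℚ ∘ ind ∘ p) xs ⟩
    t ℚ.* ℚΣ.sumOver (ℕtoℚ ∘ ind ∘ p) xs         ≡⟨ QP.*-comm t _ ⟩
    ℚΣ.sumOver (ℕtoℚ ∘ ind ∘ p) xs ℚ.* t         ≡⟨ cong (ℚ._* t) (sym (ℕtoℚ-sum (ind ∘ p) xs)) ⟩
    ℕtoℚ (ℕΣ.sumOver (ind ∘ p) xs) ℚ.* t         ∎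
  where open ≡-Reasoning

module SubsetExpansion {n m : ℕ} (G : Multigraph n m) where
  open Connectivity G
  open ChromaticSum G
  open ConstantColourings G

  signedPower : ℚ → Vec Bool m → ℚ
  signedPower L A = -1ℚ ^ℚ size A ℚ.* L ^ℚ (m ∸ size A)

  extensions-expand : ∀ {k} (φ : Vec (Fin k) n) →
    ℕtoℚ (extensions φ) ≡ ℚΣ.sumOver (λ A → ℕtoℚ (ind (constantOn A φ)) ℚ.* signedPower (ℕtoℚ k) A) (allSubsets m)
  extensions-expand {k} φ = begin
      ℕtoℚ (extensions φ)
        ≡⟨ ℕtoℚ-prod m _ ⟩
      ℚΣ.prodFin m (λ e → ℕtoℚ (weight (colour₁ e) (colour₂ e)))
        ≡⟨ ℚΣ.prodFin-cong m (λ e → ℕtoℚ-weight (colour₁ e) (colour₂ e)) ⟩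
      ℚΣ.prodFin m (λ e → ℕtoℚ k ℚ.+ negInd (same e))
        ≡⟨ ℚΣ.expand-prod m (λ _ → ℕtoℚ k) (negInd ∘ same) ⟩
      ℚΣ.sumOver (λ A → ℚΣ.prodFin m (λ e → if lookup A e then negInd (same e) else ℕtoℚ k)) (allSubsets m)
        ≡⟨ ℚΣ.sumOver-cong (λ A → subset-product (ℕtoℚ k) m A same) (allSubsets m) ⟩
      ℚΣ.sumOver (λ A → ℕtoℚ (ind (constantOn A φ)) ℚ.* signedPower (ℕtoℚ k) A) (allSubsets m) ∎
    where
    open ≡-Reasoning
    colour₁ colour₂ : Fin m → Fin k
    colour₁ e = lookup φ (end₁ e)
    colour₂ e = lookup φ (end₂ e)
    same : Fin m → Bool
    same e = colour₁ e == colour₂ e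

  chromPoly-subset-sum : ∀ k →
    ℕtoℚ (chromPoly (HG G) k) ≡ ℚΣ.sumOver (λ A → ℕtoℚ k ^ℚ c G A ℚ.* signedPower (ℕtoℚ k) A) (allSubsets m)
  chromPoly-subset-sum k = begin
      ℕtoℚ (chromPoly (HG G) k)
        ≡⟨ cong ℕtoℚ (chromPoly-as-sum k) ⟩
      ℕtoℚ (ℕΣ.sumOver extensions (allVecs k n))
        ≡⟨ ℕtoℚ-sum extensions (allVecs k n) ⟩
      ℚΣ.sumOver (λ φ → ℕtoℚ (extensions φ)) (allVecs k n)
        ≡⟨ ℚΣ.sumOver-cong extensions-expand (allVecs k n) ⟩
      ℚΣ.sumOver (λ φ → ℚΣ.sumOver (λ A → ℕtoℚ (ind (constantOn A φ)) ℚ.* t A) S) (allVecs k n)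
        ≡⟨ ℚΣ.sumOver-swap _ (allVecs k n) S ⟩
      ℚΣ.sumOver (λ A → ℚΣ.sumOver (λ φ → ℕtoℚ (ind (constantOn A φ)) ℚ.* t A) (allVecs k n)) S
        ≡⟨ ℚΣ.sumOver-cong count-A S ⟩
      ℚΣ.sumOver (λ A → ℕtoℚ k ^ℚ c G A ℚ.* t A) S ∎
    where
    open ≡-Reasoning
    S = allSubsets m
    t = signedPower (ℕtoℚ k)
    count-A : ∀ A → ℚΣ.sumOver (λ φ → ℕtoℚ (ind (constantOn A φ)) ℚ.* t A) (allVecs k n) ≡ ℕtoℚ k ^ℚ c G A ℚ.* t A
    count-A A = trans (sum-indicator (constantOn A) (t A) (allVecs k n))
                      (cong (ℚ._* t A) (trans (cong ℕtoℚ (count-constant k A)) (ℕtoℚ-^ k (c G A))))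

-- With cA = c + a, n = cA + X, s = X + b, m = s + d and b + d = a + f:
--   λ^cA (−1)^s λ^(m−s) = λ^(c+f) (−1)^(n+c) · (−λ²)^a · Z^b   whenever Z λ = −1.
summand-identity : ∀ (L Z : ℚ) → Z ℚ.* L ≡ -1ℚ → ∀ c a X b d f → b + d ≡ a + f →
  L ^ℚ (c + a) ℚ.* (-1ℚ ^ℚ (X + b) ℚ.* L ^ℚ d)
    ≡ (L ^ℚ (c + f) ℚ.* -1ℚ ^ℚ (((c + a) + X) + c)) ℚ.* ((-1ℚ ℚ.* (L ℚ.* L)) ^ℚ a ℚ.* Z ^ℚ b)
summand-identity L Z ZL≡-1 c a X b d f b+d≡a+f = begin
    L ^ℚ (c + a) ℚ.* (-1ℚ ^ℚ (X + b) ℚ.* L ^ℚ d)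
      ≡⟨ cong₂ (λ p q → p ℚ.* (q ℚ.* Ld)) (^-+ L c a) (^-+ -1ℚ X b) ⟩
    (Lc ℚ.* La) ℚ.* ((sX ℚ.* sb) ℚ.* Ld)
      ≡⟨ cong (λ q → (Lc ℚ.* La) ℚ.* ((sX ℚ.* q) ℚ.* Ld)) sign-b ⟩
    (Lc ℚ.* La) ℚ.* ((sX ℚ.* (Zb ℚ.* Lb)) ℚ.* Ld)
      ≡⟨ solve 6 (λ Lc La sX Zb Lb Ld → (Lc :* La) :* ((sX :* (Zb :* Lb)) :* Ld) := ((Lc :* sX :* La) :* Zb) :* (Lb :* Ld))
           refl Lc La sX Zb Lb Ld ⟩
    ((Lc ℚ.* sX ℚ.* La) ℚ.* Zb) ℚ.* (Lb ℚ.* Ld)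
      ≡⟨ cong (((Lc ℚ.* sX ℚ.* La) ℚ.* Zb) ℚ.*_) (trans (sym (^-+ L b d)) (trans (cong (L ^ℚ_) b+d≡a+f) (^-+ L a f))) ⟩
    ((Lc ℚ.* sX ℚ.* La) ℚ.* Zb) ℚ.* (La ℚ.* Lf)
      ≡⟨ solve 5 (λ Lc sX La Zb Lf → ((Lc :* sX :* La) :* Zb) :* (La :* Lf)
                                       := (Lc :* Lf) :* ((con 1ℚ :* con 1ℚ) :* sX) :* ((La :* La) :* Zb))
           refl Lc sX La Zb Lf ⟩
    (Lc ℚ.* Lf) ℚ.* ((1ℚ ℚ.* 1ℚ) ℚ.* sX) ℚ.* ((La ℚ.* La) ℚ.* Zb)
      ≡⟨ cong₂ (λ p q → (Lc ℚ.* Lf) ℚ.* ((p ℚ.* q) ℚ.* sX) ℚ.* ((La ℚ.* La) ℚ.* Zb)) (sym (-1^-square c)) (sym (-1^-square a)) ⟩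
    (Lc ℚ.* Lf) ℚ.* ((sc ℚ.* sc) ℚ.* (sa ℚ.* sa) ℚ.* sX) ℚ.* ((La ℚ.* La) ℚ.* Zb)
      ≡⟨ solve 7 (λ Lc Lf sc sa sX La Zb → (Lc :* Lf) :* ((sc :* sc) :* (sa :* sa) :* sX) :* ((La :* La) :* Zb)
                                           := ((Lc :* Lf) :* (((sc :* sa) :* sX) :* sc)) :* ((sa :* (La :* La)) :* Zb))
           refl Lc Lf sc sa sX La Zb ⟩
    ((Lc ℚ.* Lf) ℚ.* (((sc ℚ.* sa) ℚ.* sX) ℚ.* sc)) ℚ.* ((sa ℚ.* (La ℚ.* La)) ℚ.* Zb)
      ≡⟨ sym (cong₃ (λ p q r → (p ℚ.* q) ℚ.* (r ℚ.* Zb)) (^-+ L c f) sign-n+c (trans (^-* -1ℚ (L ℚ.* L) a) (cong (sa ℚ.*_) (^-* L L a)))) ⟩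
    (L ^ℚ (c + f) ℚ.* -1ℚ ^ℚ (((c + a) + X) + c)) ℚ.* ((-1ℚ ℚ.* (L ℚ.* L)) ^ℚ a ℚ.* Z ^ℚ b) ∎
  where
  open ≡-Reasoning
  open QS
  Lc = L ^ℚ c
  La = L ^ℚ a
  Lb = L ^ℚ b
  Ld = L ^ℚ d
  Lf = L ^ℚ f
  Zb = Z ^ℚ b
  sc = -1ℚ ^ℚ c
  sa = -1ℚ ^ℚ a
  sb = -1ℚ ^ℚ b
  sX = -1ℚ ^ℚ X
  sign-b : sb ≡ Zb ℚ.* Lb
  sign-b = trans (cong (_^ℚ b) (sym ZL≡-1)) (^-* Z L b)
  sign-n+c : -1ℚ ^ℚ (((c + a) + X) + c) ≡ ((sc ℚ.* sa) ℚ.* sX) ℚ.* sc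
  sign-n+c = trans (^-+ -1ℚ ((c + a) + X) c) (cong (ℚ._* sc) (trans (^-+ -1ℚ (c + a) X) (cong (ℚ._* sX) (^-+ -1ℚ c a))))
  cong₃ : ∀ {p p′ q q′ r r′ : ℚ} (F : ℚ → ℚ → ℚ → ℚ) → p ≡ p′ → q ≡ q′ → r ≡ r′ → F p q r ≡ F p′ q′ r′
  cong₃ F refl refl refl = refl

prefactor-exponent : ∀ c a X b d f → a + f ≡ b + d → (((X + b) + d) + 2 * c) ∸ ((c + a) + X) ≡ c + f
prefactor-exponent c a X b d f a+f≡b+d = begin
    (((X + b) + d) + 2 * c) ∸ ((c + a) + X)        ≡⟨ cong (_∸ ((c + a) + X)) (regroup₁ X b d c) ⟩
    (X + c + c + (b + d)) ∸ ((c + a) + X)          ≡⟨ cong (λ t → (X + c + c + t) ∸ ((c + a) + X)) (sym a+f≡b+d) ⟩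
    (X + c + c + (a + f)) ∸ ((c + a) + X)          ≡⟨ cong (_∸ ((c + a) + X)) (regroup₂ X c a f) ⟩
    (((c + a) + X) + (c + f)) ∸ ((c + a) + X)      ≡⟨ NP.m+n∸m≡n ((c + a) + X) (c + f) ⟩
    c + f                                          ∎
  where
  open ≡-Reasoning
  regroup₁ : ∀ X b d c → ((X + b) + d) + 2 * c ≡ X + c + c + (b + d)
  regroup₁ = solve-∀
  regroup₂ : ∀ X c a f → X + c + c + (a + f) ≡ ((c + a) + X) + (c + f)
  regroup₂ = solve-∀

rank-exponent : ∀ c a X → ((c + a) + X) ∸ c ≡ a + X
rank-exponent c a X = trans (cong (_∸ c) (NP.+-assoc c a X)) (NP.m+n∸m≡n c (a + X))

X≤s : ∀ c a X s → (c + a) + X ≤ s + (c + a) → X ≤ s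
X≤s c a X s h = NP.+-cancelʳ-≤ (c + a) X s (subst (_≤ s + (c + a)) (NP.+-comm (c + a) X) h)

a≤b+d : ∀ c a X b d → (c + a) + X ≤ ((X + b) + d) + c → a ≤ b + d
a≤b+d c a X b d h = NP.+-cancelˡ-≤ (c + X) a (b + d) (subst₂ _≤_ (regroup₁ c a X) (regroup₂ X b d c) h)
  where
  regroup₁ : ∀ c a X → (c + a) + X ≡ (c + X) + a
  regroup₁ = solve-∀
  regroup₂ : ∀ X b d c → ((X + b) + d) + c ≡ (c + X) + (b + d)
  regroup₂ = solve-∀

tutte-summand : ∀ (L Z : ℚ) → Z ℚ.* L ≡ -1ℚ → ∀ {n m c cA s} →
  c ≤ cA → cA ≤ n → s ≤ m → n ≤ s + cA → n ≤ m + c →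
  L ^ℚ cA ℚ.* (-1ℚ ^ℚ s ℚ.* L ^ℚ (m ∸ s))
    ≡ (L ^ℚ ((m + 2 * c) ∸ n) ℚ.* -1ℚ ^ℚ (n + c))
        ℚ.* ((-1ℚ ℚ.* (L ℚ.* L)) ^ℚ ((n ∸ c) ∸ (n ∸ cA)) ℚ.* Z ^ℚ (s ∸ (n ∸ cA)))
tutte-summand L Z ZL≡-1 {c = c} {s = s} c≤cA cA≤n s≤m n≤s+cA n≤m+c
  with NP.m≤n⇒∃[o]m+o≡n c≤cA
... | a , refl with NP.m≤n⇒∃[o]m+o≡n cA≤n
... | X , refl with NP.m≤n⇒∃[o]m+o≡n s≤m
... | d , refl with NP.m≤n⇒∃[o]m+o≡n (X≤s c a X s n≤s+cA)
... | b , refl with NP.m≤n⇒∃[o]m+o≡n (a≤b+d c a X b d n≤m+c)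
... | f , a+f≡b+d
  rewrite NP.m+n∸m≡n (X + b) d
        | prefactor-exponent c a X b d f a+f≡b+d
        | NP.m+n∸m≡n (c + a) X
        | NP.m+n∸m≡n X b
        | rank-exponent c a X
        | NP.m+n∸n≡m a X
  = summand-identity L Z ZL≡-1 c a X b d f (sym a+f≡b+d)

y-1-times-λ : ∀ l → (((ℤ.+ suc l ℤ.- ℤ.+ 1) ℚ./ suc l) ℚ.- 1ℚ) ℚ.* ℕtoℚ (suc l) ≡ -1ℚ
y-1-times-λ l = begin
    (y ℚ.- 1ℚ) ℚ.* L                 ≡⟨ solve 2 (λ y L → (y :- con 1ℚ) :* L := y :* L :- L) refl y L ⟩
    y ℚ.* L ℚ.- L                    ≡⟨ cong (ℚ._- L) (/-*-cancel (ℤ.+ suc l ℤ.- ℤ.+ 1) l) ⟩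
    ι (ℤ.+ suc l ℤ.- ℤ.+ 1) ℚ.- L    ≡⟨ cong (ℚ._- L) (ι-+ (ℤ.+ suc l) (ℤ.- ℤ.+ 1)) ⟩
    (L ℚ.+ -1ℚ) ℚ.- L                ≡⟨ solve 2 (λ L o → (L :+ o) :- L := o) refl L -1ℚ ⟩
    -1ℚ                              ∎
  where
  open ≡-Reasoning
  open QS
  y = (ℤ.+ suc l ℤ.- ℤ.+ 1) ℚ./ suc l
  L = ℕtoℚ (suc l)

theorem2 : (n m : ℕ) (G : Multigraph n m) (λ′ : ℕ) .{{_ : NonZero λ′}} →
    ℕtoℚ (chromPoly (HG G) λ′)
      ≡ ((ℕtoℚ (λ′)) ^ℚ ((m + 2 * cG G) ∸ n)) ℚ.*
        ((ℚ.- 1ℚ) ^ℚ (n + cG G)) ℚ.*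
        tutte G (1ℚ ℚ.- (ℕtoℚ (λ′) ℚ.* ℕtoℚ (λ′)))
                ((ℤ.+ λ′ ℤ.- ℤ.+ 1) ℚ./ λ′)
theorem2 n m G λ′@(suc l) = begin
    ℕtoℚ (chromPoly (HG G) λ′)
      ≡⟨ chromPoly-subset-sum λ′ ⟩
    ℚΣ.sumOver (λ A → L ^ℚ c G A ℚ.* signedPower L A) (allSubsets m)
      ≡⟨ ℚΣ.sumOver-cong summand (allSubsets m) ⟩
    ℚΣ.sumOver (λ A → prefactor ℚ.* tutteTerm A) (allSubsets m)
      ≡⟨ ℚΣ.sumOver-*ˡ prefactor tutteTerm (allSubsets m) ⟩
    prefactor ℚ.* tutte G x y ∎
  where
  open ≡-Reasoning
  open SubsetExpansion G
  open ComponentBounds G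
  L = ℕtoℚ λ′
  x = 1ℚ ℚ.- (L ℚ.* L)
  y = (ℤ.+ λ′ ℤ.- ℤ.+ 1) ℚ./ λ′
  prefactor = L ^ℚ ((m + 2 * cG G) ∸ n) ℚ.* -1ℚ ^ℚ (n + cG G)

  tutteTerm : Vec Bool m → ℚ
  tutteTerm A = (x ℚ.- 1ℚ) ^ℚ (rk G (allEdges m) ∸ rk G A) ℚ.* (y ℚ.- 1ℚ) ^ℚ (size A ∸ rk G A)

  x-1≡-L² : x ℚ.- 1ℚ ≡ -1ℚ ℚ.* (L ℚ.* L)
  x-1≡-L² = solve 1 (λ L → (con 1ℚ :- L :* L) :- con 1ℚ := con -1ℚ :* (L :* L)) refl L
    where open QS

  rank-E : n ≤ m + cG G
  rank-E = subst (λ s → n ≤ s + cG G) (size-allEdges m) (rank≤size (allEdges m))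

  summand : ∀ A → L ^ℚ c G A ℚ.* signedPower L A ≡ prefactor ℚ.* tutteTerm A
  summand A = trans (tutte-summand L (y ℚ.- 1ℚ) (y-1-times-λ l) (cG≤c A) (c≤n A) (size-≤ A) (rank≤size A) rank-E)
    (cong (λ z → prefactor ℚ.* (z ^ℚ (rk G (allEdges m) ∸ rk G A) ℚ.* (y ℚ.- 1ℚ) ^ℚ (size A ∸ rk G A))) (sym x-1≡-L²))
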